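{- Let $\mu=(\mu_1,\mu_2)$ be a two-row partition of $n$. For an inversion-free filling $\sigma$ of $\mu$ using each of $1,\dots,n$ once, define $\psi(\sigma)$: if $n$ is in the bottom row, $\psi(\sigma)=\sigma_\downarrow$ (remove $n$, which is at the right end of the bottom row, shift the remaining entries of the rightmost column down one row, and rearrange rows in the unique way to have no inversions); if $n$ is in the second row, remove it and reorder the remaining entries of the second row in the unique way giving no inversions. Let $d(\sigma)=\operatorname{maj}(\sigma)-\operatorname{maj}(\psi(\sigma))$. Then $d(\sigma)\in\{0,1\}$, $\psi(\sigma)$ is an inversion-free filling of $\mu^{(d(\sigma)+1)}$ with entries $1,\dots,n-1$, and $\sigma\mapsto(\psi(\sigma),d(\sigma))$ is a bijection from the inversion-free fillings of $\mu$ with entries $1,\dots,n$ onto $\bigsqcup_{d=0}^{1}\{\text{inversion-free fillings of }\mu^{(d+1)}\text{ with entries }1,\dots,n-1\}$.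
   Context: Young diagrams are in French notation (row 1 at the bottom). For a partition $\mu$ and $1\le i\le\ell(\mu)$, $\mu^{(i)}$ is obtained by removing the top cell of the column containing the last cell of row $i$ (equivalently, decreasing by one the part $\mu_j$ with largest index $j$ such that $\mu_j=\mu_i$). $\operatorname{maj}$: for each column read top to bottom as $w_1\cdots w_m$, sum indices $k$ with $w_k>w_{k+1}$, summed over columns. $\operatorname{inv}$: the number of attacking pairs (entries $u>v$ with $u,v$ in the same row and $u$ left of $v$, or $u$ in the row immediately above $v$ and strictly to its right) minus the sum of arms (cells strictly right in the row) of descent cells (cells with entry strictly greater than the entry directly below). Inversion-free means $\operatorname{inv}=0$. -}

module Defs where

open import Data.Nat as ℕ using (ℕ; zero; suc; _+_; _∸_; _≤_; _≡ᵇ_; _<ᵇ_)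
open import Data.Integer as ℤ using (ℤ; +_; _-_)
open import Data.Bool using (Bool; true; false; if_then_else_; not)
open import Data.List using (List; []; _∷_; _++_; length; map; concatMap; filter; applyUpTo; take)
open import Data.List.Relation.Binary.Permutation.Propositional using (_↭_)
open import Data.Maybe using (Maybe; just; nothing)
open import Data.Product using (_×_; _,_; proj₁; proj₂)
open import Relation.Nullary using (does)
open import Relation.Binary.PropositionalEquality using (_≡_)

-- A (two-row) filling: (bottom row r₁ , second row r₂), each read left
-- to right.  Row 1 is the bottom row (French notation).
Filling : Set
Filling = List ℕ × List ℕ

entries : ℕ → List ℕ
entries m = applyUpTo suc m

IsFilling : ℕ × ℕ → ℕ → Filling → Set
IsFilling (a , b) m (r₁ , r₂) =
  length r₁ ≡ a × length r₂ ≡ b × (r₁ ++ r₂) ↭ entries m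

countLess : ℕ → List ℕ → ℕ
countLess u [] = 0
countLess u (x ∷ xs) = (if x <ᵇ u then 1 else 0) + countLess u xs

rowInv : List ℕ → ℕ
rowInv [] = 0
rowInv (x ∷ xs) = countLess x xs + rowInv xs

-- attacking pairs between rows: u in row 2, column j, v in row 1,
-- column k < j, with u > v.  (j = index of u, 0-based)
diagInvFrom : ℕ → List ℕ → List ℕ → ℕ
diagInvFrom j r₁ [] = 0
diagInvFrom j r₁ (u ∷ us) = countLess u (take j r₁) + diagInvFrom (suc j) r₁ us

attacking : Filling → ℕ
attacking (r₁ , r₂) = rowInv r₁ + rowInv r₂ + diagInvFrom 0 r₁ r₂

-- Descent cells are the cells of row 2
-- whose entry exceeds the entry directly below; the arm of such a cell is
-- the number of cells strictly to its right in row 2.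
armSum : List ℕ → List ℕ → ℕ
armSum (v ∷ vs) (u ∷ us) = (if v <ᵇ u then length us else 0) + armSum vs us
armSum _ _ = 0

inv : Filling → ℤ
inv (r₁ , r₂) = + attacking (r₁ , r₂) - + armSum r₁ r₂

InvFree : Filling → Set
InvFree σ = inv σ ≡ + 0

-- maj: each column read top to bottom is (row-2 entry, row-1 entry) or a
-- single row-1 entry; a descent at index 1 occurs when top > bottom.
majCols : List ℕ → List ℕ → ℕ
majCols (v ∷ vs) (u ∷ us) = (if v <ᵇ u then 1 else 0) + majCols vs us
majCols _ _ = 0

maj : Filling → ℕ
maj (r₁ , r₂) = majCols r₁ r₂

-- μ^(i) for a two-row partition μ = (a , b), i ∈ {1,2}: decrease by one
-- the part μ_j with largest j such that μ_j = μ_i.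
corner : ℕ → ℕ → ℕ → ℕ × ℕ
corner a b (suc zero) = if a ≡ᵇ b then (a , b ∸ 1) else (a ∸ 1 , b)
corner a b _ = (a , b ∸ 1)

-- "the unique rearrangement with no inversions", realised by exhaustive
-- search over all rearrangements (the first inversion-free one is taken;
-- by uniqueness it is the one meant in the paper).

insertAll : ℕ → List ℕ → List (List ℕ)
insertAll x [] = (x ∷ []) ∷ []
insertAll x (y ∷ ys) = (x ∷ y ∷ ys) ∷ map (y ∷_) (insertAll x ys)

perms : List ℕ → List (List ℕ)
perms [] = [] ∷ []
perms (x ∷ xs) = concatMap (insertAll x) (perms xs)

firstInvFree : Filling → List Filling → Filling
firstInvFree dflt [] = dflt
firstInvFree dflt (τ ∷ τs) = if does (inv τ ℤ.≟ + 0) then τ else firstInvFree dflt τs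

arrangeRows : Filling → Filling
arrangeRows (r₁ , r₂) =
  firstInvFree (r₁ , r₂) (concatMap (λ p → map (λ q → (p , q)) (perms r₂)) (perms r₁))

arrangeTop : Filling → Filling
arrangeTop (r₁ , r₂) = firstInvFree (r₁ , r₂) (map (λ q → (r₁ , q)) (perms r₂))

member : ℕ → List ℕ → Bool
member n [] = false
member n (x ∷ xs) = if n ≡ᵇ x then true else member n xs

removeEntry : ℕ → List ℕ → List ℕ
removeEntry n [] = []
removeEntry n (x ∷ xs) = if n ≡ᵇ x then xs else x ∷ removeEntry n xs

initL : List ℕ → List ℕ
initL [] = []
initL (x ∷ []) = []
initL (x ∷ y ∷ ys) = x ∷ initL (y ∷ ys)

lastL : List ℕ → List ℕ
lastL [] = []
lastL (x ∷ []) = x ∷ []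
lastL (x ∷ y ∷ ys) = lastL (y ∷ ys)

-- σ↓ : remove n from the bottom row; the remaining entries of the
-- rightmost column (the row-2 cell of column μ₁, present iff μ₂ = μ₁)
-- shift down one row; then rearrange rows to have no inversions.
down : ℕ → Filling → Filling
down n (r₁ , r₂) =
  if length r₂ ≡ᵇ length r₁
  then arrangeRows (removeEntry n r₁ ++ lastL r₂ , initL r₂)
  else arrangeRows (removeEntry n r₁ , r₂)

ψ : ℕ → Filling → Filling
ψ n (r₁ , r₂) =
  if member n r₁
  then down n (r₁ , r₂)
  else arrangeTop (r₁ , removeEntry n r₂)

dd : ℕ → Filling → ℤ
dd n σ = + maj σ - + maj (ψ n σ)

IFF : ℕ × ℕ → ℕ → Filling → Set
IFF sh m σ = IsFilling sh m σ × InvFree σ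

-- For a two-row filling (r₁ , r₂) with r₂ no longer than r₁, the attacking pairs minus the arms
-- of descents count the inversions of r₁ plus the inversion triples (a row-2 entry u over v together
-- with a later row-2 entry w).  So σ is inversion-free exactly when r₁ increases and no triple is
-- inverted, and then r₂ is determined by r₁ and its set of entries; this identifies the
-- rearrangements chosen by ψ.  The position of n splits ψ into three explicit maps: at the end of
-- a short row 1, n is dropped; at the end of a full row 1, the entry m above it moves down and the
-- rest of row 1 shifts right without creating or destroying descents; in row 2, every column left
-- of n is a descent and none right of it is, so deleting n removes exactly one descent.  Each map is
-- inverted explicitly (append n; reinsert n before the first non-descent column; choose the entry
-- of row 1 to lift above n), which gives d ∈ {0,1} and the bijection.

module Submission where

open import Defs
open import Data.Nat
open import Data.Nat.Properties
open import Data.Integer as ℤ using (ℤ)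
import Data.Integer.Properties as ℤ
open import Data.Bool using (Bool; true; false; if_then_else_; T; _∧_)
open import Data.List using (List; []; _∷_; _++_; length; take; map; concatMap)
open import Data.List.Properties using (++-assoc; length-++; ∷-injective; ∷ʳ-injective; ∷ʳ-injectiveˡ; applyUpTo-∷ʳ)
open import Data.List.Relation.Unary.Any using (here; there)
open import Data.List.Relation.Unary.Unique.Propositional using (Unique)
import Data.List.Relation.Unary.Unique.Propositional.Properties as Unique
open import Data.List.Relation.Binary.Disjoint.Propositional using (Disjoint)
open import Data.List.Membership.Propositional using (_∈_; _∉_; find; lose)
open import Data.List.Membership.Propositional.Properties
  using (∈-map⁺; ∈-map⁻; ∈-concatMap⁺; ∈-concatMap⁻; ∈-∃++; ∈-++⁺ˡ; ∈-++⁺ʳ; ∈-++⁻; ∈-applyUpTo⁻; ∈-applyUpTo⁺)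
open import Data.List.Relation.Binary.Permutation.Propositional
  using (_↭_; ↭-refl; ↭-sym; ↭-trans; ↭-reflexive; prep; swap; ↭⇒↭ₛ)
open import Data.List.Relation.Binary.Permutation.Propositional.Properties
  using (∈-resp-↭; drop-mid; drop-∷; ↭-empty-inv; ¬x∷xs↭[]; ↭-length; ∷↭∷ʳ; shift; ++⁺ˡ; ++⁺ʳ)
import Data.List.Relation.Binary.Permutation.Setoid.Properties as PermutationSetoid
open import Data.List.Relation.Unary.Sorted.TotalOrder.Properties using (↗↭↗⇒≋; AllPairs⇒Sorted)
open import Data.List.Relation.Binary.Pointwise using (Pointwise-≡⇒≡)
open import Data.List.Relation.Unary.All as All using (All; []; _∷_)
open import Data.List.Relation.Unary.AllPairs as AllPairs using (AllPairs; []; _∷_)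
import Data.List.Relation.Unary.AllPairs.Properties as AllPairsₚ
open import Data.List.Relation.Unary.All.Properties using (++⁻ˡ; ++⁻ʳ; ++⁺; ∷ʳ⁻)
open import Data.Product using (_×_; _,_; proj₁; proj₂; ∃; ∃-syntax)
open import Data.Sum using (_⊎_; inj₁; inj₂; map₁)
open import Data.Unit using (⊤; tt)
open import Data.Empty using (⊥; ⊥-elim)
open import Function using (_∘_)
open import Relation.Binary.PropositionalEquality
open import Relation.Nullary using (¬_; yes; no)
open import Relation.Binary using (tri<; tri≈; tri>)
open import Algebra.Properties.CommutativeSemigroup +-commutativeSemigroup using (interchange)

toℕ : Bool → ℕ
toℕ b = if b then 1 else 0

data LessView (m n : ℕ) : Set where
  less    : m < n → (m <ᵇ n) ≡ true → LessView m n
  notLess : n ≤ m → (m <ᵇ n) ≡ false → LessView m n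

lessView : ∀ m n → LessView m n
lessView m n with m <ᵇ n in eq
... | true  = less (<ᵇ⇒< m n (subst T (sym eq) tt)) eq
... | false = notLess (≮⇒≥ (λ m<n → subst T eq (<⇒<ᵇ m<n))) eq

data EqualView (m n : ℕ) : Set where
  equal    : m ≡ n → (m ≡ᵇ n) ≡ true → EqualView m n
  notEqual : m ≢ n → (m ≡ᵇ n) ≡ false → EqualView m n

equalView : ∀ m n → EqualView m n
equalView m n with m ≡ᵇ n in eq
... | true  = equal (≡ᵇ⇒≡ m n (subst T (sym eq) tt)) eq
... | false = notEqual (λ p → subst T eq (≡⇒≡ᵇ m n p)) eq

<⇒<ᵇ≡true : ∀ {m n} → m < n → (m <ᵇ n) ≡ true
<⇒<ᵇ≡true {m} {n} m<n with lessView m n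
... | less _ e      = e
... | notLess n≤m _ = ⊥-elim (<⇒≱ m<n n≤m)

≥⇒<ᵇ≡false : ∀ {m n} → n ≤ m → (m <ᵇ n) ≡ false
≥⇒<ᵇ≡false {m} {n} n≤m with lessView m n
... | less m<n _  = ⊥-elim (<⇒≱ m<n n≤m)
... | notLess _ e = e

toℕ-< : ∀ {m n} → m < n → toℕ (m <ᵇ n) ≡ 1
toℕ-< m<n rewrite <⇒<ᵇ≡true m<n = refl

toℕ-≥ : ∀ {m n} → n ≤ m → toℕ (m <ᵇ n) ≡ 0
toℕ-≥ n≤m rewrite ≥⇒<ᵇ≡false n≤m = refl

≡ᵇ-refl : ∀ n → (n ≡ᵇ n) ≡ true
≡ᵇ-refl zero    = refl
≡ᵇ-refl (suc n) = ≡ᵇ-refl n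

≡⇒≡ᵇ≡true : ∀ {m n} → m ≡ n → (m ≡ᵇ n) ≡ true
≡⇒≡ᵇ≡true {m} refl = ≡ᵇ-refl m

suc[n∸1]≡n : ∀ {n} → 1 ≤ n → suc (n ∸ 1) ≡ n
suc[n∸1]≡n {suc n} _ = refl

length-∷ʳ : ∀ (xs : List ℕ) x → length (xs ++ x ∷ []) ≡ suc (length xs)
length-∷ʳ xs x = trans (length-++ xs) (+-comm (length xs) 1)

true≢false : true ≢ false
true≢false ()

∧≡true⇒ : ∀ {a b} → (a ∧ b) ≡ true → a ≡ true × b ≡ true
∧≡true⇒ {true} {true} _ = refl , refl

+m-+n≡+k⇒m≡k+n : ∀ m n k → ℤ.+ m ℤ.- ℤ.+ n ≡ ℤ.+ k → m ≡ k + n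
+m-+n≡+k⇒m≡k+n m n k e = m⊖n≡+k⇒ m n (trans (sym (ℤ.[+m]-[+n]≡m⊖n m n)) e)
  where
  m⊖n≡+k⇒ : ∀ m n → m ℤ.⊖ n ≡ ℤ.+ k → m ≡ k + n
  m⊖n≡+k⇒ m       zero    e = trans (ℤ.+-injective e) (sym (+-identityʳ k))
  m⊖n≡+k⇒ (suc m) (suc n) e =
    trans (cong suc (m⊖n≡+k⇒ m n (trans (sym (ℤ.[1+m]⊖[1+n]≡m⊖n m n)) e))) (sym (+-suc k n))

m≡k+n⇒+m-+n≡+k : ∀ m n k → m ≡ k + n → ℤ.+ m ℤ.- ℤ.+ n ≡ ℤ.+ k
m≡k+n⇒+m-+n≡+k .(k + n) n k refl =
  trans (ℤ.[+m]-[+n]≡m⊖n (k + n) n) (trans (ℤ.⊖-≥ (m≤n+m n k)) (cong ℤ.+_ (m+n∸n≡m k n)))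

-- Inversion-free two-row fillings

Ascending : List ℕ → Set
Ascending = AllPairs _≤_

-- u is a row-2 entry, v the entry below it and w a row-2 entry further right.
NonInvTriple : ℕ → ℕ → ℕ → Set
NonInvTriple u v w = (v < u → w ≤ v ⊎ u ≤ w) × (u ≤ v → u ≤ w × w ≤ v)

NoInvTriples : List ℕ → List ℕ → Set
NoInvTriples (v ∷ vs) (u ∷ us) = All (NonInvTriple u v) us × NoInvTriples vs us
NoInvTriples _        _        = ⊤

countGreater : ℕ → List ℕ → ℕ
countGreater v []       = 0
countGreater v (w ∷ ws) = toℕ (v <ᵇ w) + countGreater v ws

invTriple : ℕ → ℕ → ℕ → ℕ
invTriple u v w = (toℕ (w <ᵇ u) + toℕ (v <ᵇ w)) ∸ toℕ (v <ᵇ u)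

invTriplesWith : ℕ → ℕ → List ℕ → ℕ
invTriplesWith u v []       = 0
invTriplesWith u v (w ∷ ws) = invTriple u v w + invTriplesWith u v ws

invTriples : List ℕ → List ℕ → ℕ
invTriples (v ∷ vs) (u ∷ us) = invTriplesWith u v us + invTriples vs us
invTriples _        _        = 0

-- The truncated subtraction in invTriple never truncates: that would need v < u ≤ w ≤ v.
invTriple-spec : ∀ u v w → toℕ (w <ᵇ u) + toℕ (v <ᵇ w) ≡ toℕ (v <ᵇ u) + invTriple u v w
invTriple-spec u v w with lessView w u | lessView v w | lessView v u
... | less _ e₁    | less _ e₂    | less _ e₃    rewrite e₁ | e₂ | e₃ = refl
... | less _ e₁    | less _ e₂    | notLess _ e₃ rewrite e₁ | e₂ | e₃ = refl
... | less _ e₁    | notLess _ e₂ | less _ e₃    rewrite e₁ | e₂ | e₃ = refl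
... | less _ e₁    | notLess _ e₂ | notLess _ e₃ rewrite e₁ | e₂ | e₃ = refl
... | notLess _ e₁ | less _ e₂    | less _ e₃    rewrite e₁ | e₂ | e₃ = refl
... | notLess _ e₁ | less _ e₂    | notLess _ e₃ rewrite e₁ | e₂ | e₃ = refl
... | notLess u≤w _ | notLess w≤v _ | less v<u _  = ⊥-elim (<⇒≱ v<u (≤-trans u≤w w≤v))
... | notLess _ e₁ | notLess _ e₂ | notLess _ e₃ rewrite e₁ | e₂ | e₃ = refl

countLess+countGreater : ∀ u v ws →
  countLess u ws + countGreater v ws ≡ (if v <ᵇ u then length ws else 0) + invTriplesWith u v ws
countLess+countGreater u v [] with v <ᵇ u
... | true  = refl
... | false = refl
countLess+countGreater u v (w ∷ ws) = begin
  (toℕ (w <ᵇ u) + countLess u ws) + (toℕ (v <ᵇ w) + countGreater v ws)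
    ≡⟨ interchange (toℕ (w <ᵇ u)) _ _ _ ⟩
  (toℕ (w <ᵇ u) + toℕ (v <ᵇ w)) + (countLess u ws + countGreater v ws)
    ≡⟨ cong₂ _+_ (invTriple-spec u v w) (countLess+countGreater u v ws) ⟩
  (toℕ (v <ᵇ u) + invTriple u v w) + ((if v <ᵇ u then length ws else 0) + invTriplesWith u v ws)
    ≡⟨ interchange (toℕ (v <ᵇ u)) _ _ _ ⟩
  (toℕ (v <ᵇ u) + (if v <ᵇ u then length ws else 0)) + invTriplesWith u v (w ∷ ws)
    ≡⟨ cong (_+ invTriplesWith u v (w ∷ ws)) (arm (v <ᵇ u)) ⟩
  (if v <ᵇ u then length (w ∷ ws) else 0) + invTriplesWith u v (w ∷ ws) ∎
  where
  open ≡-Reasoning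
  arm : ∀ b → toℕ b + (if b then length ws else 0) ≡ (if b then suc (length ws) else 0)
  arm true  = refl
  arm false = refl

diagInvFrom-∷ : ∀ j v vs us → diagInvFrom (suc j) (v ∷ vs) us ≡ countGreater v us + diagInvFrom j vs us
diagInvFrom-∷ j v vs []       = refl
diagInvFrom-∷ j v vs (w ∷ ws) =
  trans (cong (toℕ (v <ᵇ w) + countLess w (take j vs) +_) (diagInvFrom-∷ (suc j) v vs ws))
        (interchange (toℕ (v <ᵇ w)) _ _ _)

-- Grouped by columns, the column of u over v contributes the later row-2 entries w with w < u or
-- v < w; these count the arm of u if the column is a descent, plus the inversion triples (u , v , w).
rowInv+diagInv≡armSum+invTriples : ∀ r₁ r₂ → length r₂ ≤ length r₁ →
  rowInv r₂ + diagInvFrom 0 r₁ r₂ ≡ armSum r₁ r₂ + invTriples r₁ r₂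
rowInv+diagInv≡armSum+invTriples []       []       _ = refl
rowInv+diagInv≡armSum+invTriples (_ ∷ _)  []       _ = refl
rowInv+diagInv≡armSum+invTriples (v ∷ vs) (u ∷ us) (s≤s le) = begin
  (countLess u us + rowInv us) + diagInvFrom 1 (v ∷ vs) us
    ≡⟨ cong (countLess u us + rowInv us +_) (diagInvFrom-∷ 0 v vs us) ⟩
  (countLess u us + rowInv us) + (countGreater v us + diagInvFrom 0 vs us)
    ≡⟨ interchange (countLess u us) _ _ _ ⟩
  (countLess u us + countGreater v us) + (rowInv us + diagInvFrom 0 vs us)
    ≡⟨ cong₂ _+_ (countLess+countGreater u v us) (rowInv+diagInv≡armSum+invTriples vs us le) ⟩
  ((if v <ᵇ u then length us else 0) + invTriplesWith u v us) + (armSum vs us + invTriples vs us)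
    ≡⟨ interchange (if v <ᵇ u then length us else 0) _ _ _ ⟩
  armSum (v ∷ vs) (u ∷ us) + invTriples (v ∷ vs) (u ∷ us) ∎
  where open ≡-Reasoning

attacking≡ : ∀ r₁ r₂ → length r₂ ≤ length r₁ →
  attacking (r₁ , r₂) ≡ (rowInv r₁ + invTriples r₁ r₂) + armSum r₁ r₂
attacking≡ r₁ r₂ le = begin
  (rowInv r₁ + rowInv r₂) + diagInvFrom 0 r₁ r₂   ≡⟨ +-assoc (rowInv r₁) _ _ ⟩
  rowInv r₁ + (rowInv r₂ + diagInvFrom 0 r₁ r₂)   ≡⟨ cong (rowInv r₁ +_) (rowInv+diagInv≡armSum+invTriples r₁ r₂ le) ⟩
  rowInv r₁ + (armSum r₁ r₂ + invTriples r₁ r₂)   ≡⟨ cong (rowInv r₁ +_) (+-comm (armSum r₁ r₂) _) ⟩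
  rowInv r₁ + (invTriples r₁ r₂ + armSum r₁ r₂)   ≡⟨ +-assoc (rowInv r₁) _ _ ⟨
  (rowInv r₁ + invTriples r₁ r₂) + armSum r₁ r₂   ∎
  where open ≡-Reasoning

countLess≡0⇒All≤ : ∀ x xs → countLess x xs ≡ 0 → All (x ≤_) xs
countLess≡0⇒All≤ x []       _ = []
countLess≡0⇒All≤ x (y ∷ ys) e with lessView y x
... | less y<x _    = ⊥-elim (1+n≢0 (trans (sym (toℕ-< y<x)) (m+n≡0⇒m≡0 _ e)))
... | notLess x≤y _ = x≤y ∷ countLess≡0⇒All≤ x ys (m+n≡0⇒n≡0 (toℕ (y <ᵇ x)) e)

All≤⇒countLess≡0 : ∀ x xs → All (x ≤_) xs → countLess x xs ≡ 0
All≤⇒countLess≡0 x []       []          = refl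
All≤⇒countLess≡0 x (y ∷ ys) (x≤y ∷ x≤ys) rewrite ≥⇒<ᵇ≡false x≤y = All≤⇒countLess≡0 x ys x≤ys

rowInv≡0⇒ascending : ∀ r → rowInv r ≡ 0 → Ascending r
rowInv≡0⇒ascending []       _ = []
rowInv≡0⇒ascending (x ∷ xs) e =
  countLess≡0⇒All≤ x xs (m+n≡0⇒m≡0 _ e) ∷ rowInv≡0⇒ascending xs (m+n≡0⇒n≡0 (countLess x xs) e)

ascending⇒rowInv≡0 : ∀ r → Ascending r → rowInv r ≡ 0
ascending⇒rowInv≡0 []       []         = refl
ascending⇒rowInv≡0 (x ∷ xs) (x≤xs ∷ s) rewrite All≤⇒countLess≡0 x xs x≤xs = ascending⇒rowInv≡0 xs s

invTriple≡0⇒nonInvTriple : ∀ u v w → invTriple u v w ≡ 0 → NonInvTriple u v w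
invTriple≡0⇒nonInvTriple u v w e with lessView w u | lessView v w | lessView v u
... | less _ e₁     | less _ e₂     | less _ e₃     rewrite e₁ | e₂ | e₃ = ⊥-elim (1+n≢0 e)
... | less _ e₁     | less _ e₂     | notLess _ e₃  rewrite e₁ | e₂ | e₃ = ⊥-elim (1+n≢0 e)
... | less _ _      | notLess w≤v _ | less v<u _    = (λ _ → inj₁ w≤v) , (λ u≤v → ⊥-elim (<⇒≱ v<u u≤v))
... | less _ e₁     | notLess _ e₂  | notLess _ e₃  rewrite e₁ | e₂ | e₃ = ⊥-elim (1+n≢0 e)
... | notLess u≤w _ | less _ _      | less v<u _    = (λ _ → inj₂ u≤w) , (λ u≤v → ⊥-elim (<⇒≱ v<u u≤v))
... | notLess _ e₁  | less _ e₂     | notLess _ e₃  rewrite e₁ | e₂ | e₃ = ⊥-elim (1+n≢0 e)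
... | notLess u≤w _ | notLess w≤v _ | less v<u _    = ⊥-elim (<⇒≱ v<u (≤-trans u≤w w≤v))
... | notLess u≤w _ | notLess w≤v _ | notLess _ _   = (λ v<u → ⊥-elim (<⇒≱ v<u (≤-trans u≤w w≤v))) , (λ _ → u≤w , w≤v)

nonInvTriple⇒invTriple≡0 : ∀ u v w → NonInvTriple u v w → invTriple u v w ≡ 0
nonInvTriple⇒invTriple≡0 u v w (v<u⇒ , u≤v⇒) with lessView w u | lessView v w | lessView v u
... | less w<u _    | less v<w _    | less v<u _    with v<u⇒ v<u
...   | inj₁ w≤v = ⊥-elim (<⇒≱ v<w w≤v)
...   | inj₂ u≤w = ⊥-elim (<⇒≱ w<u u≤w)
nonInvTriple⇒invTriple≡0 u v w (_ , u≤v⇒) | less w<u _ | less _ _  | notLess u≤v _ = ⊥-elim (<⇒≱ w<u (proj₁ (u≤v⇒ u≤v)))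
nonInvTriple⇒invTriple≡0 u v w _ | less _ e₁    | notLess _ e₂ | less _ e₃    rewrite e₁ | e₂ | e₃ = refl
nonInvTriple⇒invTriple≡0 u v w (_ , u≤v⇒) | less w<u _ | notLess _ _ | notLess u≤v _ = ⊥-elim (<⇒≱ w<u (proj₁ (u≤v⇒ u≤v)))
nonInvTriple⇒invTriple≡0 u v w _ | notLess _ e₁ | less _ e₂    | less _ e₃    rewrite e₁ | e₂ | e₃ = refl
nonInvTriple⇒invTriple≡0 u v w (_ , u≤v⇒) | notLess _ _ | less v<w _ | notLess u≤v _ = ⊥-elim (<⇒≱ v<w (proj₂ (u≤v⇒ u≤v)))
nonInvTriple⇒invTriple≡0 u v w _ | notLess u≤w _ | notLess w≤v _ | less v<u _ = ⊥-elim (<⇒≱ v<u (≤-trans u≤w w≤v))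
nonInvTriple⇒invTriple≡0 u v w _ | notLess _ e₁ | notLess _ e₂ | notLess _ e₃ rewrite e₁ | e₂ | e₃ = refl

invTriples≡0⇒noInvTriples : ∀ r₁ r₂ → invTriples r₁ r₂ ≡ 0 → NoInvTriples r₁ r₂
invTriples≡0⇒noInvTriples []       _        _ = tt
invTriples≡0⇒noInvTriples (_ ∷ _)  []       _ = tt
invTriples≡0⇒noInvTriples (v ∷ vs) (u ∷ us) e =
  column us (m+n≡0⇒m≡0 _ e) , invTriples≡0⇒noInvTriples vs us (m+n≡0⇒n≡0 (invTriplesWith u v us) e)
  where
  column : ∀ ws → invTriplesWith u v ws ≡ 0 → All (NonInvTriple u v) ws
  column []       _ = []
  column (w ∷ ws) e = invTriple≡0⇒nonInvTriple u v w (m+n≡0⇒m≡0 _ e) ∷ column ws (m+n≡0⇒n≡0 (invTriple u v w) e)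

noInvTriples⇒invTriples≡0 : ∀ r₁ r₂ → NoInvTriples r₁ r₂ → invTriples r₁ r₂ ≡ 0
noInvTriples⇒invTriples≡0 []       _        _        = refl
noInvTriples⇒invTriples≡0 (_ ∷ _)  []       _        = refl
noInvTriples⇒invTriples≡0 (v ∷ vs) (u ∷ us) (cs , g) =
  cong₂ _+_ (column us cs) (noInvTriples⇒invTriples≡0 vs us g)
  where
  column : ∀ ws → All (NonInvTriple u v) ws → invTriplesWith u v ws ≡ 0
  column []       []       = refl
  column (w ∷ ws) (c ∷ cs) rewrite nonInvTriple⇒invTriple≡0 u v w c = column ws cs

-- Since every term of attacking − armSum is a nonnegative count, inv vanishes exactly when
-- row 1 increases and there are no inversion triples.
invFree⇒ascending×noInvTriples : ∀ r₁ r₂ → length r₂ ≤ length r₁ → InvFree (r₁ , r₂) →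
  Ascending r₁ × NoInvTriples r₁ r₂
invFree⇒ascending×noInvTriples r₁ r₂ le e =
  rowInv≡0⇒ascending r₁ (m+n≡0⇒m≡0 _ rest≡0) ,
  invTriples≡0⇒noInvTriples r₁ r₂ (m+n≡0⇒n≡0 (rowInv r₁) rest≡0)
  where
  rest≡0 : rowInv r₁ + invTriples r₁ r₂ ≡ 0
  rest≡0 = +-cancelʳ-≡ (armSum r₁ r₂) _ 0
    (trans (sym (attacking≡ r₁ r₂ le)) (+m-+n≡+k⇒m≡k+n (attacking (r₁ , r₂)) (armSum r₁ r₂) 0 e))

ascending×noInvTriples⇒invFree : ∀ r₁ r₂ → length r₂ ≤ length r₁ → Ascending r₁ → NoInvTriples r₁ r₂ →
  InvFree (r₁ , r₂)
ascending×noInvTriples⇒invFree r₁ r₂ le s g = m≡k+n⇒+m-+n≡+k (attacking (r₁ , r₂)) (armSum r₁ r₂) 0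
  (trans (attacking≡ r₁ r₂ le)
         (cong (_+ armSum r₁ r₂) (cong₂ _+_ (ascending⇒rowInv≡0 r₁ s) (noInvTriples⇒invTriples≡0 r₁ r₂ g))))

∈-insertAll⇒↭ : ∀ y zs xs → xs ∈ insertAll y zs → xs ↭ y ∷ zs
∈-insertAll⇒↭ y []       xs (here refl) = ↭-refl
∈-insertAll⇒↭ y (z ∷ zs) xs (here refl) = ↭-refl
∈-insertAll⇒↭ y (z ∷ zs) xs (there m) with ∈-map⁻ (z ∷_) m
... | q , q∈ , refl = ↭-trans (prep z (∈-insertAll⇒↭ y zs q q∈)) (swap z y ↭-refl)

∈-perms⇒↭ : ∀ ys xs → xs ∈ perms ys → xs ↭ ys
∈-perms⇒↭ []       xs (here refl) = ↭-refl
∈-perms⇒↭ (y ∷ ys) xs m with find (∈-concatMap⁻ (insertAll y) {xs = perms ys} m)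
... | p , p∈ , xs∈ = ↭-trans (∈-insertAll⇒↭ y p xs xs∈) (prep y (∈-perms⇒↭ ys p p∈))

++-∷-∈-insertAll : ∀ y p q → p ++ y ∷ q ∈ insertAll y (p ++ q)
++-∷-∈-insertAll y []      []      = here refl
++-∷-∈-insertAll y []      (z ∷ q) = here refl
++-∷-∈-insertAll y (z ∷ p) q       = there (∈-map⁺ (z ∷_) (++-∷-∈-insertAll y p q))

↭⇒∈-perms : ∀ ys xs → xs ↭ ys → xs ∈ perms ys
↭⇒∈-perms []       xs xs↭ rewrite ↭-empty-inv xs↭ = here refl
↭⇒∈-perms (y ∷ ys) xs xs↭ with ∈-∃++ (∈-resp-↭ (↭-sym xs↭) (here refl))
... | p , q , refl = ∈-concatMap⁺ (insertAll y) {xs = perms ys}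
        (lose (↭⇒∈-perms ys (p ++ q) (drop-mid p [] xs↭)) (++-∷-∈-insertAll y p q))

firstInvFree-invFree : ∀ d L τ → τ ∈ L → InvFree τ → firstInvFree d L ∈ L × InvFree (firstInvFree d L)
firstInvFree-invFree d (σ ∷ L) τ τ∈ τ-free with inv σ ℤ.≟ ℤ.+ 0
... | yes σ-free = here refl , σ-free
firstInvFree-invFree d (σ ∷ L) τ (here refl) τ-free | no σ-not-free = ⊥-elim (σ-not-free τ-free)
firstInvFree-invFree d (σ ∷ L) τ (there τ∈) τ-free | no _ =
  let (found∈ , found-free) = firstInvFree-invFree d L τ τ∈ τ-free in there found∈ , found-free

rowRearrangements : List ℕ → List ℕ → List Filling
rowRearrangements r₁ r₂ = concatMap (λ p → map (λ q → (p , q)) (perms r₂)) (perms r₁)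

topRearrangements : List ℕ → List ℕ → List Filling
topRearrangements r₁ r₂ = map (λ q → (r₁ , q)) (perms r₂)

∈-rowRearrangements⇒ : ∀ r₁ r₂ σ → σ ∈ rowRearrangements r₁ r₂ → proj₁ σ ↭ r₁ × proj₂ σ ↭ r₂
∈-rowRearrangements⇒ r₁ r₂ σ m
  with p , p∈ , m′ ← find (∈-concatMap⁻ (λ p → map (λ q → (p , q)) (perms r₂)) {xs = perms r₁} m)
  with q , q∈ , refl ← ∈-map⁻ (λ q → (p , q)) m′
  = ∈-perms⇒↭ r₁ p p∈ , ∈-perms⇒↭ r₂ q q∈

↭⇒∈-rowRearrangements : ∀ r₁ r₂ p q → p ↭ r₁ → q ↭ r₂ → (p , q) ∈ rowRearrangements r₁ r₂
↭⇒∈-rowRearrangements r₁ r₂ p q p↭ q↭ =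
  ∈-concatMap⁺ (λ p → map (λ q → (p , q)) (perms r₂)) {xs = perms r₁}
    (lose (↭⇒∈-perms r₁ p p↭) (∈-map⁺ (λ q → (p , q)) (↭⇒∈-perms r₂ q q↭)))

∈-topRearrangements⇒ : ∀ r₁ r₂ σ → σ ∈ topRearrangements r₁ r₂ → proj₁ σ ≡ r₁ × proj₂ σ ↭ r₂
∈-topRearrangements⇒ r₁ r₂ σ m with q , q∈ , refl ← ∈-map⁻ (λ q → (r₁ , q)) m = refl , ∈-perms⇒↭ r₂ q q∈

arrangeRows-invFree : ∀ r₁ r₂ p q → p ↭ r₁ → q ↭ r₂ → InvFree (p , q) →
  proj₁ (arrangeRows (r₁ , r₂)) ↭ r₁ × proj₂ (arrangeRows (r₁ , r₂)) ↭ r₂ × InvFree (arrangeRows (r₁ , r₂))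
arrangeRows-invFree r₁ r₂ p q p↭ q↭ pq-free =
  let (found∈ , found-free) = firstInvFree-invFree (r₁ , r₂) (rowRearrangements r₁ r₂) (p , q)
                                (↭⇒∈-rowRearrangements r₁ r₂ p q p↭ q↭) pq-free
      (found₁↭ , found₂↭) = ∈-rowRearrangements⇒ r₁ r₂ _ found∈
  in found₁↭ , found₂↭ , found-free

arrangeTop-invFree : ∀ r₁ r₂ q → q ↭ r₂ → InvFree (r₁ , q) →
  proj₁ (arrangeTop (r₁ , r₂)) ≡ r₁ × proj₂ (arrangeTop (r₁ , r₂)) ↭ r₂ × InvFree (arrangeTop (r₁ , r₂))
arrangeTop-invFree r₁ r₂ q q↭ q-free =
  let (found∈ , found-free) = firstInvFree-invFree (r₁ , r₂) (topRearrangements r₁ r₂) (r₁ , q)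
                                (∈-map⁺ (λ q → (r₁ , q)) (↭⇒∈-perms r₂ q q↭)) q-free
      (found₁≡ , found₂↭) = ∈-topRearrangements⇒ r₁ r₂ _ found∈
  in found₁≡ , found₂↭ , found-free

-- Uniqueness of inversion-free arrangements

ascending-↭⇒≡ : ∀ {xs ys} → Ascending xs → Ascending ys → xs ↭ ys → xs ≡ ys
ascending-↭⇒≡ xs↗ ys↗ xs↭ys =
  Pointwise-≡⇒≡ (↗↭↗⇒≋ ≤-totalOrder (AllPairs⇒Sorted ≤-totalOrder xs↗) (AllPairs⇒Sorted ≤-totalOrder ys↗) (↭⇒↭ₛ xs↭ys))

unique-resp-↭ : ∀ {xs ys : List ℕ} → xs ↭ ys → Unique xs → Unique ys
unique-resp-↭ xs↭ys = PermutationSetoid.Unique-resp-↭ (setoid ℕ) (↭⇒↭ₛ xs↭ys)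

nonInvTriple-asym : ∀ {u v u′} → u ≢ v → u′ ≢ v → u ≢ u′ → NonInvTriple u v u′ → NonInvTriple u′ v u → ⊥
nonInvTriple-asym {u} {v} {u′} u≢v u′≢v u≢u′ (v<u⇒ , u≤v⇒) (v<u′⇒ , u′≤v⇒) with <-cmp v u | <-cmp v u′
... | tri≈ _ v≡u _ | _            = u≢v (sym v≡u)
... | _            | tri≈ _ v≡u′ _ = u′≢v (sym v≡u′)
... | tri< v<u _ _ | tri< v<u′ _ _ with v<u⇒ v<u | v<u′⇒ v<u′
...   | inj₁ u′≤v | _         = <⇒≱ v<u′ u′≤v
...   | inj₂ _    | inj₁ u≤v  = <⇒≱ v<u u≤v
...   | inj₂ u≤u′ | inj₂ u′≤u = u≢u′ (≤-antisym u≤u′ u′≤u)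
nonInvTriple-asym _ _ _ _ (_ , u′≤v⇒) | tri< v<u _ _ | tri> _ _ u′<v = <⇒≱ v<u (proj₂ (u′≤v⇒ (<⇒≤ u′<v)))
nonInvTriple-asym _ _ _ (_ , u≤v⇒) _ | tri> _ _ u<v | tri< v<u′ _ _ = <⇒≱ v<u′ (proj₂ (u≤v⇒ (<⇒≤ u<v)))
nonInvTriple-asym _ _ u≢u′ (_ , u≤v⇒) (_ , u′≤v⇒) | tri> _ _ u<v | tri> _ _ u′<v =
  u≢u′ (≤-antisym (proj₁ (u≤v⇒ (<⇒≤ u<v))) (proj₁ (u′≤v⇒ (<⇒≤ u′<v))))

-- Given row 1, row 2 of an inversion-free filling is determined by its entries: the first
-- position where two candidates differ would carry contradictory triples.
noInvTriples-top-unique : ∀ V U U′ → length U ≤ length V → NoInvTriples V U → NoInvTriples V U′ →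
  U ↭ U′ → Unique U → Disjoint U V → U ≡ U′
noInvTriples-top-unique V [] U′ _ _ _ U↭U′ _ _ = sym (↭-empty-inv (↭-sym U↭U′))
noInvTriples-top-unique V (u ∷ us) [] _ _ _ U↭U′ _ _ = ⊥-elim (¬x∷xs↭[] U↭U′)
noInvTriples-top-unique (v ∷ vs) (u ∷ us) (u′ ∷ us′) (s≤s le) (cs , g) (cs′ , g′) U↭U′ (_ ∷ us!) U#V
  with u ≟ u′
... | yes refl = cong (u ∷_)
  (noInvTriples-top-unique vs us us′ le g g′ (drop-∷ U↭U′) us! (λ (x∈us , x∈vs) → U#V (there x∈us , there x∈vs)))
... | no u≢u′ with ∈-resp-↭ U↭U′ (here refl) | ∈-resp-↭ (↭-sym U↭U′) (here refl)
...   | here u≡u′    | _              = ⊥-elim (u≢u′ u≡u′)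
...   | there _      | here u′≡u      = ⊥-elim (u≢u′ (sym u′≡u))
...   | there u∈us′  | there u′∈us    = ⊥-elim (nonInvTriple-asym
          (λ u≡v → U#V (here refl , here u≡v)) (λ u′≡v → U#V (there u′∈us , here u′≡v)) u≢u′
          (All.lookup cs u′∈us) (All.lookup cs′ u∈us′))

arrangeRows-unique : ∀ r₁ r₂ p q → p ↭ r₁ → q ↭ r₂ → length q ≤ length p → Ascending p → NoInvTriples p q →
  Unique q → Disjoint q p → arrangeRows (r₁ , r₂) ≡ (p , q)
arrangeRows-unique r₁ r₂ p q p↭ q↭ le p↗ g q! q#p
  with arrangeRows (r₁ , r₂) | arrangeRows-invFree r₁ r₂ p q p↭ q↭ (ascending×noInvTriples⇒invFree p q le p↗ g)
... | p′ , q′ | p′↭ , q′↭ , p′q′-free = sym (cong₂ _,_ p≡p′ q≡q′)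
  where
  p↭p′ : p ↭ p′
  p↭p′ = ↭-trans p↭ (↭-sym p′↭)
  q↭q′ : q ↭ q′
  q↭q′ = ↭-trans q↭ (↭-sym q′↭)
  le′ : length q′ ≤ length p′
  le′ = subst₂ _≤_ (↭-length q↭q′) (↭-length p↭p′) le
  p′↗ : Ascending p′
  p′↗ = proj₁ (invFree⇒ascending×noInvTriples p′ q′ le′ p′q′-free)
  g′ : NoInvTriples p′ q′
  g′ = proj₂ (invFree⇒ascending×noInvTriples p′ q′ le′ p′q′-free)
  p≡p′ : p ≡ p′
  p≡p′ = ascending-↭⇒≡ p↗ p′↗ p↭p′
  q≡q′ : q ≡ q′
  q≡q′ = noInvTriples-top-unique p q q′ le g (subst (λ z → NoInvTriples z q′) (sym p≡p′) g′) q↭q′ q! q#p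

arrangeTop-unique : ∀ r₁ r₂ q → q ↭ r₂ → length q ≤ length r₁ → Ascending r₁ → NoInvTriples r₁ q →
  Unique q → Disjoint q r₁ → arrangeTop (r₁ , r₂) ≡ (r₁ , q)
arrangeTop-unique r₁ r₂ q q↭ le r₁↗ g q! q#r₁
  with arrangeTop (r₁ , r₂) | arrangeTop-invFree r₁ r₂ q q↭ (ascending×noInvTriples⇒invFree r₁ q le r₁↗ g)
... | .r₁ , q′ | refl , q′↭ , q′-free = cong (r₁ ,_) (sym q≡q′)
  where
  q↭q′ : q ↭ q′
  q↭q′ = ↭-trans q↭ (↭-sym q′↭)
  le′ : length q′ ≤ length r₁
  le′ = subst (_≤ length r₁) (↭-length q↭q′) le
  q≡q′ : q ≡ q′
  q≡q′ = noInvTriples-top-unique r₁ q q′ le g (proj₂ (invFree⇒ascending×noInvTriples r₁ q′ le′ q′-free)) q↭q′ q! q#r₁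

-- The maximal entry in row 2

BelowHead : List ℕ → List ℕ → Set
BelowHead []      us = ⊤
BelowHead (v ∷ _) us = All (_≤ v) us

belowHead : ∀ {v} vs {us} → All (v ≤_) vs → All (_≤ v) us → BelowHead vs us
belowHead []      _          _    = tt
belowHead (_ ∷ _) (v≤v′ ∷ _) us≤v = All.map (λ u≤v → ≤-trans u≤v v≤v′) us≤v

ascending×belowHead⇒noInvTriples : ∀ V us → length us ≤ length V → Ascending V → Ascending us →
  BelowHead V us → NoInvTriples V us
ascending×belowHead⇒noInvTriples []       []       _ _ _ _ = tt
ascending×belowHead⇒noInvTriples (_ ∷ _)  []       _ _ _ _ = tt
ascending×belowHead⇒noInvTriples (v ∷ vs) (u ∷ us) (s≤s le) (v≤vs ∷ vs↗) (u≤us ∷ us↗) (u≤v ∷ us≤v) =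
  All.zipWith (λ (u≤w , w≤v) → (λ v<u → ⊥-elim (<⇒≱ v<u u≤v)) , (λ _ → u≤w , w≤v)) (u≤us , us≤v) ,
  ascending×belowHead⇒noInvTriples vs us le vs↗ us↗ (belowHead vs v≤vs us≤v)

belowHead⇒majCols≡0 : ∀ V us → Ascending V → BelowHead V us → majCols V us ≡ 0
belowHead⇒majCols≡0 []       us       _ _ = refl
belowHead⇒majCols≡0 (_ ∷ _)  []       _ _ = refl
belowHead⇒majCols≡0 (v ∷ vs) (u ∷ us) (v≤vs ∷ vs↗) (u≤v ∷ us≤v) rewrite toℕ-≥ u≤v =
  belowHead⇒majCols≡0 vs us vs↗ (belowHead vs v≤vs us≤v)

nonDescent⇒ascending×below : ∀ v vs u us → length us ≤ length vs → Ascending (v ∷ vs) →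
  NoInvTriples (v ∷ vs) (u ∷ us) → u ≤ v → Ascending (u ∷ us) × All (_≤ v) (u ∷ us)
nonDescent⇒ascending×below v vs u [] _ _ _ u≤v = ([] ∷ []) , (u≤v ∷ [])
nonDescent⇒ascending×below v (v′ ∷ vs) u (w ∷ ws) (s≤s le) (v≤ ∷ vs↗) (cs , g) u≤v =
  (All.map (λ c → proj₁ (proj₂ c u≤v)) cs ∷ w∷ws↗) , (u≤v ∷ All.map (λ c → proj₂ (proj₂ c u≤v)) cs)
  where
  w≤v : w ≤ v
  w≤v = proj₂ (proj₂ (All.head cs) u≤v)
  w∷ws↗ : Ascending (w ∷ ws)
  w∷ws↗ = proj₁ (nonDescent⇒ascending×below v′ vs w ws le vs↗ g (≤-trans w≤v (All.head v≤)))

-- Inverse of removing the largest entry n from row 2.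
insertMax : ℕ → List ℕ → List ℕ → List ℕ
insertMax n _        []       = n ∷ []
insertMax n []       (u ∷ us) = n ∷ u ∷ us
insertMax n (v ∷ vs) (u ∷ us) = if v <ᵇ u then u ∷ insertMax n vs us else n ∷ u ∷ us

insertMax-↭ : ∀ n V X → insertMax n V X ↭ n ∷ X
insertMax-↭ n V        []       = ↭-refl
insertMax-↭ n []       (u ∷ us) = ↭-refl
insertMax-↭ n (v ∷ vs) (u ∷ us) with v <ᵇ u
... | true  = ↭-trans (prep u (insertMax-↭ n vs us)) (swap u n ↭-refl)
... | false = ↭-refl

All-insertMax : ∀ {P : ℕ → Set} n V X → P n → All P X → All P (insertMax n V X)
All-insertMax n V        []       pn _          = pn ∷ []
All-insertMax n []       (u ∷ us) pn pX         = pn ∷ pX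
All-insertMax n (v ∷ vs) (u ∷ us) pn (pu ∷ pus) with v <ᵇ u
... | true  = pu ∷ All-insertMax n vs us pn pus
... | false = pn ∷ pu ∷ pus

removeEntry-insertMax : ∀ n V X → All (_< n) X → removeEntry n (insertMax n V X) ≡ X
removeEntry-insertMax n V        []       _ rewrite ≡ᵇ-refl n = refl
removeEntry-insertMax n []       (u ∷ us) _ rewrite ≡ᵇ-refl n = refl
removeEntry-insertMax n (v ∷ vs) (u ∷ us) (u<n ∷ us<n) with v <ᵇ u
... | false rewrite ≡ᵇ-refl n = refl
... | true with equalView n u
...   | equal n≡u _     = ⊥-elim (<⇒≢ u<n (sym n≡u))
...   | notEqual _ n≢ᵇu rewrite n≢ᵇu = cong (u ∷_) (removeEntry-insertMax n vs us us<n)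

insertMax-noInvTriples : ∀ n V X → length X < length V → Ascending V → NoInvTriples V X →
  All (_< n) V → All (_≤ n) X → NoInvTriples V (insertMax n V X)
insertMax-noInvTriples n (v ∷ [])    []       _ _ _ _ _ = [] , tt
insertMax-noInvTriples n (v ∷ _ ∷ _) []       _ _ _ _ _ = [] , tt
insertMax-noInvTriples n (v ∷ vs) (u ∷ us) (s≤s le) (v≤vs ∷ vs↗) (cs , g) (v<n ∷ vs<n) (u≤n ∷ us≤n)
  with lessView v u
... | less v<u v<ᵇu rewrite v<ᵇu =
  All-insertMax n vs us ((λ _ → inj₂ u≤n) , (λ u≤v → ⊥-elim (<⇒≱ v<u u≤v))) cs ,
  insertMax-noInvTriples n vs us le vs↗ g vs<n us≤n
... | notLess u≤v v≮ᵇu rewrite v≮ᵇu =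
  All.map (λ w≤v → (λ _ → inj₁ w≤v) , (λ n≤v → ⊥-elim (<⇒≱ v<n n≤v))) (u∷us≤v) ,
  ascending×belowHead⇒noInvTriples vs (u ∷ us) le vs↗ u∷us↗ (belowHead vs v≤vs u∷us≤v)
  where
  u∷us↗×≤v : Ascending (u ∷ us) × All (_≤ v) (u ∷ us)
  u∷us↗×≤v = nonDescent⇒ascending×below v vs u us (≤-trans (n≤1+n _) le) (v≤vs ∷ vs↗) (cs , g) u≤v
  u∷us↗ : Ascending (u ∷ us)
  u∷us↗ = proj₁ u∷us↗×≤v
  u∷us≤v : All (_≤ v) (u ∷ us)
  u∷us≤v = proj₂ u∷us↗×≤v

insertMax-nonDescent : ∀ n v vs us → All (_≤ v) us → insertMax n (v ∷ vs) us ≡ n ∷ us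
insertMax-nonDescent n v vs []       _         = refl
insertMax-nonDescent n v vs (w ∷ ws) (w≤v ∷ _) rewrite ≥⇒<ᵇ≡false w≤v = refl

belowHead⇒ascending : ∀ V us → length us ≤ length V → Ascending V → NoInvTriples V us → BelowHead V us →
  Ascending us
belowHead⇒ascending V        []       _        _  _ _         = []
belowHead⇒ascending (v ∷ vs) (u ∷ us) (s≤s le) V↗ g (u≤v ∷ _) =
  proj₁ (nonDescent⇒ascending×below v vs u us le V↗ g u≤v)

All-removeEntry : ∀ {P : ℕ → Set} n xs → All P xs → All P (removeEntry n xs)
All-removeEntry n []       []         = []
All-removeEntry n (x ∷ xs) (px ∷ pxs) with n ≡ᵇ x
... | true  = pxs
... | false = px ∷ All-removeEntry n xs pxs

-- Every column left of n is a descent (a triple (u , v , n) with u ≤ v < n is an inversion)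
-- and every column right of it is not (a triple (n , v , w) with v < n forces w ≤ v).
removeMax-top : ∀ n V U → length U ≤ length V → Ascending V → NoInvTriples V U → All (_< n) V → All (_≤ n) U →
  Unique U → n ∈ U →
  NoInvTriples V (removeEntry n U) × majCols V U ≡ suc (majCols V (removeEntry n U))
  × insertMax n V (removeEntry n U) ≡ U
removeMax-top n []       (u ∷ us) () _ _ _ _ _ _
removeMax-top n (v ∷ vs) (u ∷ us) (s≤s le) (v≤vs ∷ vs↗) (cs , g) (v<n ∷ vs<n) (u≤n ∷ us≤n) (u≢us ∷ us!) n∈U
  with equalView n u
... | equal refl n≡ᵇn rewrite n≡ᵇn | <⇒<ᵇ≡true v<n =
  ascending×belowHead⇒noInvTriples (v ∷ vs) us (≤-trans le (n≤1+n _)) (v≤vs ∷ vs↗) us↗ us≤v ,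
  cong suc (trans (belowHead⇒majCols≡0 vs us vs↗ (belowHead vs v≤vs us≤v))
                  (sym (belowHead⇒majCols≡0 (v ∷ vs) us (v≤vs ∷ vs↗) us≤v))) ,
  insertMax-nonDescent n v vs us us≤v
  where
  below : ∀ {w} → w ∈ us → w ≤ v
  below w∈ with proj₁ (All.lookup cs w∈) v<n
  ... | inj₁ w≤v = w≤v
  ... | inj₂ n≤w = ⊥-elim (All.lookup u≢us w∈ (≤-antisym n≤w (All.lookup us≤n w∈)))
  us≤v : All (_≤ v) us
  us≤v = All.tabulate below
  us↗ : Ascending us
  us↗ = belowHead⇒ascending vs us le vs↗ g (belowHead vs v≤vs us≤v)
... | notEqual n≢u n≢ᵇu rewrite n≢ᵇu with n∈U
...   | here n≡u = ⊥-elim (n≢u n≡u)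
...   | there n∈us with lessView v u
...     | notLess u≤v _ = ⊥-elim (<⇒≱ v<n (proj₂ (proj₂ (All.lookup cs n∈us) u≤v)))
...     | less _ v<ᵇu rewrite v<ᵇu =
  let (g′ , maj≡ , ins≡) = removeMax-top n vs us le vs↗ g vs<n us≤n us! n∈us
  in (All-removeEntry n us cs , g′) , cong suc maj≡ , cong (u ∷_) ins≡

-- The maximal entry at the end of row 1

noInvTriples-++⁻ : ∀ V Z U → length U ≤ length V → NoInvTriples (V ++ Z) U → NoInvTriples V U
noInvTriples-++⁻ []       Z []       _        _        = tt
noInvTriples-++⁻ (_ ∷ _)  Z []       _        _        = tt
noInvTriples-++⁻ (v ∷ vs) Z (u ∷ us) (s≤s le) (cs , g) = cs , noInvTriples-++⁻ vs Z us le g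

noInvTriples-++⁺ : ∀ V Z U → length U ≤ length V → NoInvTriples V U → NoInvTriples (V ++ Z) U
noInvTriples-++⁺ []       []      []       _        _        = tt
noInvTriples-++⁺ []       (_ ∷ _) []       _        _        = tt
noInvTriples-++⁺ (_ ∷ _)  Z       []       _        _        = tt
noInvTriples-++⁺ (v ∷ vs) Z       (u ∷ us) (s≤s le) (cs , g) = cs , noInvTriples-++⁺ vs Z us le g

majCols-++ : ∀ V Z U → length U ≤ length V → majCols (V ++ Z) U ≡ majCols V U
majCols-++ []       []      []       _        = refl
majCols-++ []       (_ ∷ _) []       _        = refl
majCols-++ (_ ∷ _)  Z       []       _        = refl
majCols-++ (v ∷ vs) Z       (u ∷ us) (s≤s le) = cong (toℕ (v <ᵇ u) +_) (majCols-++ vs Z us le)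

-- The maximal entry at the end of a full row 1

insert : ℕ → List ℕ → List ℕ
insert m []       = m ∷ []
insert m (v ∷ vs) = if m <ᵇ v then m ∷ v ∷ vs else v ∷ insert m vs

insert-↭ : ∀ m V → insert m V ↭ m ∷ V
insert-↭ m []       = ↭-refl
insert-↭ m (v ∷ vs) with m <ᵇ v
... | true  = ↭-refl
... | false = ↭-trans (prep v (insert-↭ m vs)) (swap v m ↭-refl)

All-insert : ∀ {P : ℕ → Set} m V → P m → All P V → All P (insert m V)
All-insert m []       pm _          = pm ∷ []
All-insert m (v ∷ vs) pm (pv ∷ pvs) with m <ᵇ v
... | true  = pm ∷ pv ∷ pvs
... | false = pv ∷ All-insert m vs pm pvs

All-insert⁻ : ∀ {P : ℕ → Set} m V → All P (insert m V) → All P V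
All-insert⁻ m []       _ = []
All-insert⁻ m (v ∷ vs) p with m <ᵇ v
... | true  = All.tail p
... | false = All.head p ∷ All-insert⁻ m vs (All.tail p)

insert-ascending : ∀ m V → Ascending V → Ascending (insert m V)
insert-ascending m []       _            = [] ∷ []
insert-ascending m (v ∷ vs) (v≤vs ∷ vs↗) with lessView m v
... | less m<v m<ᵇv rewrite m<ᵇv = (<⇒≤ m<v ∷ All.map (≤-trans (<⇒≤ m<v)) v≤vs) ∷ v≤vs ∷ vs↗
... | notLess v≤m m≮ᵇv rewrite m≮ᵇv = All-insert m vs v≤m v≤vs ∷ insert-ascending m vs vs↗

ascending-++⁻ˡ : ∀ S R → Ascending (S ++ R) → Ascending S
ascending-++⁻ˡ []      R _           = []
ascending-++⁻ˡ (x ∷ S) R (x≤ ∷ S++R↗) = ++⁻ˡ S x≤ ∷ ascending-++⁻ˡ S R S++R↗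

ascending-∷ʳ⁺ : ∀ V n → Ascending V → All (_≤ n) V → Ascending (V ++ n ∷ [])
ascending-∷ʳ⁺ V n V↗ V≤n = AllPairsₚ.++⁺ V↗ ([] ∷ []) (All.map (_∷ []) V≤n)

≤-last-top : ∀ n m V U v w → length U ≡ length V → NoInvTriples (V ++ n ∷ []) (U ++ m ∷ []) → All (v ≤_) V →
  w ∈ U → w ≤ v → w ≤ m
≤-last-top n m (b ∷ bs) (x ∷ xs) v w _  (cs , _) (v≤b ∷ _)   (here refl) w≤v =
  proj₁ (proj₂ (proj₂ (∷ʳ⁻ cs)) (≤-trans w≤v v≤b))
≤-last-top n m (b ∷ bs) (x ∷ xs) v w le (_ , g)  (_ ∷ v≤bs) (there w∈)  w≤v =
  ≤-last-top n m bs xs v w (suc-injective le) g v≤bs w∈ w≤v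

-- Shifting row 1 one column to the right, with y entering on the left and n leaving on the
-- right, while the last entry m of row 2 is dropped, changes neither the descents nor the triples.
shiftBottomRight : ∀ n m y V U → length U ≡ length V → NoInvTriples (V ++ n ∷ []) (U ++ m ∷ []) →
  Ascending (V ++ n ∷ []) → m ≤ y → All (y ≤_) V → m < n →
  NoInvTriples (y ∷ V) U × majCols (y ∷ V) U ≡ majCols (V ++ n ∷ []) (U ++ m ∷ [])
shiftBottomRight n m y [] [] _ _ _ _ _ m<n rewrite toℕ-≥ (<⇒≤ m<n) = tt , refl
shiftBottomRight n m y (v ∷ V) (u ∷ U) le (cs , g) (v≤ ∷ V++n↗) m≤y (y≤v ∷ _) m<n =
  (column (lessView v u) , proj₁ rest) , cong₂ _+_ (sameDescent (lessView v u)) (proj₂ rest)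
  where
  rest : NoInvTriples (v ∷ V) U × majCols (v ∷ V) U ≡ majCols (V ++ n ∷ []) (U ++ m ∷ [])
  rest = shiftBottomRight n m v V U (suc-injective le) g V++n↗ (≤-trans m≤y y≤v) (++⁻ˡ V v≤) m<n
  U-triples : All (NonInvTriple u v) U
  U-triples = ++⁻ˡ U cs
  m-triple : NonInvTriple u v m
  m-triple = proj₂ (∷ʳ⁻ cs)
  below-m : ∀ {w} → w ∈ U → w ≤ v → w ≤ y
  below-m w∈ w≤v = ≤-trans (≤-last-top n m V U v _ (suc-injective le) g (++⁻ˡ V v≤) w∈ w≤v) m≤y
  column : LessView v u → All (NonInvTriple u y) U
  column (less v<u _) = All.tabulate λ w∈ →
    (λ _ → map₁ (below-m w∈) (proj₁ (All.lookup U-triples w∈) v<u)) ,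
    (λ u≤y → ⊥-elim (<⇒≱ v<u (≤-trans u≤y y≤v)))
  column (notLess u≤v _) = All.tabulate λ w∈ →
    (λ y<u → ⊥-elim (<⇒≱ y<u (≤-trans (proj₁ (proj₂ m-triple u≤v)) m≤y))) ,
    (λ _ → proj₁ (proj₂ (All.lookup U-triples w∈) u≤v) , below-m w∈ (proj₂ (proj₂ (All.lookup U-triples w∈) u≤v)))
  sameDescent : LessView v u → toℕ (y <ᵇ u) ≡ toℕ (v <ᵇ u)
  sameDescent (less v<u _)    = trans (toℕ-< (≤-<-trans y≤v v<u)) (sym (toℕ-< v<u))
  sameDescent (notLess u≤v _) = trans (toℕ-≥ (≤-trans (proj₁ (proj₂ m-triple u≤v)) m≤y)) (sym (toℕ-≥ u≤v))

-- ψ for a full row 1 with n in its last column: m moves down into row 1.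
moveDown : ∀ n m V U → length U ≡ length V → NoInvTriples (V ++ n ∷ []) (U ++ m ∷ []) →
  Ascending (V ++ n ∷ []) → m < n →
  NoInvTriples (insert m V) U × majCols (V ++ n ∷ []) (U ++ m ∷ []) ≡ majCols (insert m V) U
moveDown n m [] [] _ _ _ m<n rewrite toℕ-≥ (<⇒≤ m<n) = tt , refl
moveDown n m (v ∷ V) (u ∷ U) le (cs , g) V++n↗@(v≤ ∷ rest↗) m<n with lessView m v
... | less m<v m<ᵇv rewrite m<ᵇv =
  let (g′ , maj≡) = shiftBottomRight n m m (v ∷ V) (u ∷ U) le (cs , g) V++n↗ ≤-refl
                      (<⇒≤ m<v ∷ All.map (≤-trans (<⇒≤ m<v)) (++⁻ˡ V v≤)) m<n
  in g′ , sym maj≡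
... | notLess v≤m m≮ᵇv rewrite m≮ᵇv =
  let (g′ , maj≡) = moveDown n m V U (suc-injective le) g rest↗ m<n
  in (++⁻ˡ U cs , g′) , cong (toℕ (v <ᵇ u) +_) maj≡

insert-split : ∀ m L → m ∉ L → ∃ λ S → ∃ λ R → L ≡ S ++ R × insert m L ≡ S ++ m ∷ R × All (_< m) S
insert-split m []       _   = [] , [] , refl , refl , []
insert-split m (v ∷ vs) m∉ with lessView m v
... | less _ m<ᵇv rewrite m<ᵇv = [] , v ∷ vs , refl , refl , []
... | notLess v≤m m≮ᵇv rewrite m≮ᵇv =
  let (S , R , vs≡ , ins≡ , S<m) = insert-split m vs (m∉ ∘ there)
  in v ∷ S , R , cong (v ∷_) vs≡ , cong (v ∷_) ins≡ , ≤∧≢⇒< v≤m (λ v≡m → m∉ (here (sym v≡m))) ∷ S<m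

-- At the first column where the two rows 1 differ (z against m′), the triples of its row-2 entry
-- with the last row-2 entries m′ and m contradict each other.
moveDown-clash : ∀ n m m′ z S R X → length X ≡ suc (length S + length R) →
  NoInvTriples (z ∷ S ++ R ++ n ∷ []) (X ++ m′ ∷ []) → NoInvTriples (S ++ m′ ∷ R ++ n ∷ []) (X ++ m ∷ []) →
  m ≤ z → Ascending (z ∷ S) → All (_< m′) (z ∷ S) → ⊥
moveDown-clash n m m′ z [] R (x ∷ X) _ (cs , _) (cs′ , _) m≤z _ (z<m′ ∷ _) with lessView z x
... | notLess x≤z _ = <⇒≱ z<m′ (proj₂ (proj₂ (proj₂ (∷ʳ⁻ cs)) x≤z))
... | less z<x _ with proj₁ (proj₂ (∷ʳ⁻ cs)) z<x
...   | inj₁ m′≤z = <⇒≱ z<m′ m′≤z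
...   | inj₂ x≤m′ = <⇒≱ z<x (≤-trans (proj₁ (proj₂ (proj₂ (∷ʳ⁻ cs′)) x≤m′)) m≤z)
moveDown-clash n m m′ z (s ∷ S) R (x ∷ X) le (_ , g) (_ , g′) m≤z (z≤ ∷ S↗) (_ ∷ S<m′) =
  moveDown-clash n m m′ s S R X (suc-injective le) g g′ (≤-trans m≤z (All.head z≤)) S↗ S<m′

moveDown-clash′ : ∀ n m m′ v V v′ V′ X → length X ≡ suc (length V′) →
  NoInvTriples (v ∷ V ++ n ∷ []) (X ++ m ∷ []) → NoInvTriples (v′ ∷ V′ ++ n ∷ []) (X ++ m′ ∷ []) →
  Ascending (v′ ∷ V′) → m′ ∉ V′ → m ≡ v′ → v ∷ V ≡ insert m′ V′ → m < m′ → ⊥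
moveDown-clash′ n m m′ v V v′ V′ X le g g′ (v′≤ ∷ V′↗) m′∉ refl v∷V≡ m<m′ with insert-split m′ V′ m′∉
... | S , R , refl , ins≡ , S<m′ =
  moveDown-clash n m m′ m S R X (trans le (cong suc (length-++ S)))
    (subst (λ L → NoInvTriples (m ∷ L) (X ++ m′ ∷ [])) (++-assoc S R (n ∷ [])) g′)
    (subst (λ L → NoInvTriples L (X ++ m ∷ []))
       (trans (cong (_++ n ∷ []) (trans v∷V≡ ins≡)) (++-assoc S (m′ ∷ R) (n ∷ []))) g)
    ≤-refl (++⁻ˡ S v′≤ ∷ ascending-++⁻ˡ S R V′↗) (m<m′ ∷ S<m′)

moveDown-injective : ∀ n m m′ V V′ X → length X ≡ length V → length X ≡ length V′ →
  NoInvTriples (V ++ n ∷ []) (X ++ m ∷ []) → NoInvTriples (V′ ++ n ∷ []) (X ++ m′ ∷ []) →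
  Ascending V → Ascending V′ → m ∉ V → m′ ∉ V′ → insert m V ≡ insert m′ V′ → m ≡ m′
moveDown-injective n m m′ V V′ X l l′ g g′ V↗ V′↗ m∉ m′∉ ins≡ with m ≟ m′
... | yes m≡m′ = m≡m′
... | no m≢m′ = ⊥-elim (distinct-impossible V V′ X l l′ g g′ V↗ V′↗ m∉ m′∉ ins≡)
  where
  distinct-impossible : ∀ V V′ X → length X ≡ length V → length X ≡ length V′ →
    NoInvTriples (V ++ n ∷ []) (X ++ m ∷ []) → NoInvTriples (V′ ++ n ∷ []) (X ++ m′ ∷ []) →
    Ascending V → Ascending V′ → m ∉ V → m′ ∉ V′ → insert m V ≡ insert m′ V′ → ⊥
  distinct-impossible []      []       X       _ _  _ _ _ _ _ _ ins≡ = m≢m′ (proj₁ (∷-injective ins≡))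
  distinct-impossible []      (_ ∷ _)  X       l l′ _ _ _ _ _ _ _ with () ← trans (sym l) l′
  distinct-impossible (_ ∷ _) []       X       l l′ _ _ _ _ _ _ _ with () ← trans (sym l) l′
  distinct-impossible (v ∷ V) (v′ ∷ V′) (x ∷ X) l l′ g g′ V↗ V′↗ m∉ m′∉ ins≡ with lessView m v | lessView m′ v′
  ... | less _ m<ᵇv | less _ m′<ᵇv′ rewrite m<ᵇv | m′<ᵇv′ = m≢m′ (proj₁ (∷-injective ins≡))
  ... | notLess _ m≮ᵇv | notLess _ m′≮ᵇv′ rewrite m≮ᵇv | m′≮ᵇv′ with refl , ins≡′ ← ∷-injective ins≡ =
    distinct-impossible V V′ X (suc-injective l) (suc-injective l′) (proj₂ g) (proj₂ g′)
      (AllPairs.tail V↗) (AllPairs.tail V′↗)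
       (m∉ ∘ there) (m′∉ ∘ there) ins≡′
  ... | less _ m<ᵇv | notLess v′≤m′ m′≮ᵇv′ rewrite m<ᵇv | m′≮ᵇv′ with m≡v′ , v∷V≡ ← ∷-injective ins≡ =
    moveDown-clash′ n m m′ v V v′ V′ (x ∷ X) l′ g g′ V′↗ (m′∉ ∘ there) m≡v′ v∷V≡
      (≤∧≢⇒< (subst (_≤ m′) (sym m≡v′) v′≤m′) m≢m′)
  ... | notLess v≤m m≮ᵇv | less _ m′<ᵇv′ rewrite m≮ᵇv | m′<ᵇv′ with v≡m′ , V≡ ← ∷-injective ins≡ =
    moveDown-clash′ n m′ m v′ V′ v V (x ∷ X) l g′ g V↗ (m∉ ∘ there) (sym v≡m′) (sym V≡)
      (≤∧≢⇒< (subst (_≤ m) v≡m′ v≤m) (m≢m′ ∘ sym))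

-- Whether the preimage of (W , X) under ψ lifts the first entry of W above n.
liftsHead : List ℕ → List ℕ → Bool
liftsHead _             []       = true
liftsHead (w₁ ∷ w₂ ∷ W) (x₁ ∷ X) = if w₁ <ᵇ x₁ then (w₂ <ᵇ x₁) ∧ liftsHead (w₂ ∷ W) X else true
liftsHead _             _        = true

AllNonDescent : (ℕ → Set) → List ℕ → List ℕ → Set
AllNonDescent P (v ∷ vs) (u ∷ us) = (u ≤ v → P u) × AllNonDescent P vs us
AllNonDescent P _        _        = ⊤

All⇒AllNonDescent : ∀ {P : ℕ → Set} V X → All P X → AllNonDescent P V X
All⇒AllNonDescent []       _        _          = tt
All⇒AllNonDescent (_ ∷ _)  []       _          = tt
All⇒AllNonDescent (v ∷ vs) (u ∷ us) (pu ∷ pus) = (λ _ → pu) , All⇒AllNonDescent vs us pus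

AllNonDescent-zip : ∀ {P Q R : ℕ → Set} V X → AllNonDescent P V X → All Q X → (∀ {z} → P z → Q z → R z) →
  AllNonDescent R V X
AllNonDescent-zip []       _        _          _          _ = tt
AllNonDescent-zip (_ ∷ _)  []       _          _          _ = tt
AllNonDescent-zip (v ∷ vs) (u ∷ us) (pu , pus) (qu ∷ qus) f = (λ u≤v → f (pu u≤v) qu) , AllNonDescent-zip vs us pus qus f

AllNonDescent⇒All : ∀ {P : ℕ → Set} V X → length X ≤ length V → Ascending V → AllNonDescent P V X →
  BelowHead V X → All P X
AllNonDescent⇒All V        []       _        _            _          _            = []
AllNonDescent⇒All (v ∷ vs) (u ∷ us) (s≤s le) (v≤vs ∷ vs↗) (pu , pus) (u≤v ∷ us≤v) =
  pu u≤v ∷ AllNonDescent⇒All vs us le vs↗ pus (belowHead vs v≤vs us≤v)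

liftsHead⇒nonDescents≤head : ∀ w₁ W X → length X ≤ length W → NoInvTriples (w₁ ∷ W) X → Ascending (w₁ ∷ W) →
  liftsHead (w₁ ∷ W) X ≡ true → AllNonDescent (_≤ w₁) (w₁ ∷ W) X
liftsHead⇒nonDescents≤head w₁ W         []        _        _        _          _ = tt
liftsHead⇒nonDescents≤head w₁ (w₂ ∷ W) (x₁ ∷ X) (s≤s le) (cs , g) (w₁≤ ∷ W↗) lifts with lessView w₁ x₁
... | less w₁<x₁ w₁<ᵇx₁ rewrite w₁<ᵇx₁ =
  (λ x₁≤w₁ → ⊥-elim (<⇒≱ w₁<x₁ x₁≤w₁)) ,
  AllNonDescent-zip (w₂ ∷ W) X (liftsHead⇒nonDescents≤head w₂ W X le g W↗ (proj₂ (∧≡true⇒ lifts))) cs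
    (λ z≤w₂ c → below z≤w₂ (proj₁ c w₁<x₁))
  where
  w₂<x₁ : w₂ < x₁
  w₂<x₁ = <ᵇ⇒< w₂ x₁ (subst T (sym (proj₁ (∧≡true⇒ lifts))) tt)
  below : ∀ {z} → z ≤ w₂ → z ≤ w₁ ⊎ x₁ ≤ z → z ≤ w₁
  below _    (inj₁ z≤w₁) = z≤w₁
  below z≤w₂ (inj₂ x₁≤z) = ⊥-elim (<⇒≱ w₂<x₁ (≤-trans x₁≤z z≤w₂))
... | notLess x₁≤w₁ _ =
  (λ _ → x₁≤w₁) ,
  All⇒AllNonDescent (w₂ ∷ W) X
    (All.tail (proj₂ (nonDescent⇒ascending×below w₁ (w₂ ∷ W) x₁ X (≤-trans le (n≤1+n _)) (w₁≤ ∷ W↗) (cs , g) x₁≤w₁)))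

liftHead-noInvTriples : ∀ n y w₁ W X → length W ≡ length X → NoInvTriples (w₁ ∷ W) X → Ascending (w₁ ∷ W) →
  All (_≤ n) W → liftsHead (w₁ ∷ W) X ≡ true → AllNonDescent (_≤ y) (w₁ ∷ W) X → y ≤ w₁ →
  NoInvTriples (W ++ n ∷ []) (X ++ y ∷ [])
liftHead-noInvTriples n y w₁ []       []       _  _        _            _            _     _        _    = [] , tt
liftHead-noInvTriples n y w₁ (w₂ ∷ W) (x₁ ∷ X) le (cs , g) (w₁≤ ∷ W↗) (w₂≤n ∷ W≤n) lifts (x₁≤y , ys) y≤w₁
  with lessView w₁ x₁
... | less w₁<x₁ w₁<ᵇx₁ rewrite w₁<ᵇx₁ =
  ++⁺ (All.map (λ c → (λ _ → map₁ (λ z≤w₁ → ≤-trans z≤w₁ w₁≤w₂) (proj₁ c w₁<x₁)) , ⊥-elim ∘ x₁≰w₂) cs)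
      (((λ _ → inj₁ (≤-trans y≤w₁ w₁≤w₂)) , ⊥-elim ∘ x₁≰w₂) ∷ []) ,
  liftHead-noInvTriples n y w₂ W X (suc-injective le) g W↗ W≤n (proj₂ (∧≡true⇒ lifts)) ys (≤-trans y≤w₁ w₁≤w₂)
  where
  w₁≤w₂ : w₁ ≤ w₂
  w₁≤w₂ = All.head w₁≤
  x₁≰w₂ : ¬ x₁ ≤ w₂
  x₁≰w₂ = <⇒≱ (<ᵇ⇒< w₂ x₁ (subst T (sym (proj₁ (∧≡true⇒ lifts))) tt))
... | notLess x₁≤w₁ _ =
  ascending×belowHead⇒noInvTriples (w₂ ∷ W ++ n ∷ []) (x₁ ∷ X ++ y ∷ []) lengths
    (ascending-∷ʳ⁺ (w₂ ∷ W) n W↗ (w₂≤n ∷ W≤n)) (ascending-∷ʳ⁺ (x₁ ∷ X) y X↗ X≤y)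
    (All.map (λ z≤w₁ → ≤-trans z≤w₁ (All.head w₁≤)) (++⁺ X≤w₁ (y≤w₁ ∷ [])))
  where
  |X|≤|W| : length (x₁ ∷ X) ≤ length (w₂ ∷ W)
  |X|≤|W| = ≤-reflexive (sym le)
  X↗×≤w₁ : Ascending (x₁ ∷ X) × All (_≤ w₁) (x₁ ∷ X)
  X↗×≤w₁ = nonDescent⇒ascending×below w₁ (w₂ ∷ W) x₁ X (≤-trans (≤-pred |X|≤|W|) (n≤1+n _)) (w₁≤ ∷ W↗) (cs , g) x₁≤w₁
  X↗ : Ascending (x₁ ∷ X)
  X↗ = proj₁ X↗×≤w₁
  X≤w₁ : All (_≤ w₁) (x₁ ∷ X)
  X≤w₁ = proj₂ X↗×≤w₁
  X≤y : All (_≤ y) (x₁ ∷ X)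
  X≤y = AllNonDescent⇒All (w₁ ∷ w₂ ∷ W) (x₁ ∷ X) (≤-trans |X|≤|W| (n≤1+n _)) (w₁≤ ∷ W↗) (x₁≤y , ys) X≤w₁
  lengths : length (x₁ ∷ X ++ y ∷ []) ≤ length (w₂ ∷ W ++ n ∷ [])
  lengths = subst₂ _≤_ (sym (length-∷ʳ (x₁ ∷ X) y)) (sym (length-∷ʳ (w₂ ∷ W) n)) (s≤s |X|≤|W|)

HeadAtMost : List ℕ → ℕ → Set
HeadAtMost []      _ = ⊤
HeadAtMost (x ∷ _) w = x ≤ w

-- A preimage of (W , X) under ψ for a full row 1: W = insert lifted rest, and lifted goes on top of n.
record Lift (n : ℕ) (W X : List ℕ) : Set where
  field
    rest       : List ℕ
    lifted     : ℕ
    insert≡    : insert lifted rest ≡ W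
    length≡    : length rest ≡ length X
    triples    : NoInvTriples (rest ++ n ∷ []) (X ++ lifted ∷ [])
    ascending  : Ascending (rest ++ n ∷ [])
    headLifted : liftsHead W X ≡ true → W ≡ lifted ∷ rest
    X≤lifted   : liftsHead W X ≡ false → HeadAtMost X lifted

insert-least : ∀ m V → All (m <_) V → insert m V ≡ m ∷ V
insert-least m []      _         = refl
insert-least m (v ∷ V) (m<v ∷ _) rewrite <⇒<ᵇ≡true m<v = refl

liftHead : ∀ n w₁ W X → length (w₁ ∷ W) ≡ suc (length X) → NoInvTriples (w₁ ∷ W) X → Ascending (w₁ ∷ W) →
  Unique (w₁ ∷ W) → All (_≤ n) (w₁ ∷ W) → liftsHead (w₁ ∷ W) X ≡ true → Lift n (w₁ ∷ W) X
liftHead n w₁ W X le g W↗@(w₁≤ ∷ W↗′) (w₁≢ ∷ _) (_ ∷ W≤n) lifts = record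
  { rest       = W
  ; lifted     = w₁
  ; insert≡    = insert-least w₁ W (All.zipWith (λ (w₁≤w , w₁≢w) → ≤∧≢⇒< w₁≤w w₁≢w) (w₁≤ , w₁≢))
  ; length≡    = suc-injective le
  ; triples    = liftHead-noInvTriples n w₁ w₁ W X (suc-injective le) g W↗ W≤n lifts
                   (liftsHead⇒nonDescents≤head w₁ W X (≤-reflexive (sym (suc-injective le))) g W↗ lifts) ≤-refl
  ; ascending  = ascending-∷ʳ⁺ W n W↗′ W≤n
  ; headLifted = λ _ → refl
  ; X≤lifted   = λ notLifts → ⊥-elim (true≢false (trans (sym lifts) notLifts))
  }

liftsHead≡false⇒descent : ∀ w₂ W x₂ X → liftsHead (w₂ ∷ W) (x₂ ∷ X) ≡ false → w₂ < x₂
liftsHead≡false⇒descent w₂ []       x₂ X ()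
liftsHead≡false⇒descent w₂ (w₃ ∷ W) x₂ X notLifts with lessView w₂ x₂
... | less w₂<x₂ _ = w₂<x₂
... | notLess _ w₂≮ᵇx₂ rewrite w₂≮ᵇx₂ = ⊥-elim (true≢false notLifts)

x₁≤lifted : ∀ n w₁ w₂ W x₁ X → w₁ ≤ w₂ → w₁ < x₁ → All (NonInvTriple x₁ w₁) X →
  ((w₂ <ᵇ x₁) ∧ liftsHead (w₂ ∷ W) X) ≡ false → (L : Lift n (w₂ ∷ W) X) → x₁ ≤ Lift.lifted L
x₁≤lifted n w₁ w₂ W x₁ X w₁≤w₂ w₁<x₁ cs notLifts L with liftsHead (w₂ ∷ W) X in lifts
... | true with refl , _ ← ∷-injective (Lift.headLifted L lifts) with lessView w₂ x₁
...   | notLess x₁≤w₂ _ = x₁≤w₂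
...   | less _ w₂<ᵇx₁ rewrite w₂<ᵇx₁ = ⊥-elim (true≢false notLifts)
x₁≤lifted n w₁ w₂ W x₁ []       _     _     _       _        _ | false = ⊥-elim (true≢false lifts)
x₁≤lifted n w₁ w₂ W x₁ (x₂ ∷ X) w₁≤w₂ w₁<x₁ (c ∷ _) notLifts L | false with proj₁ c w₁<x₁
... | inj₂ x₁≤x₂ = ≤-trans x₁≤x₂ (Lift.X≤lifted L lifts)
... | inj₁ x₂≤w₁ = ⊥-elim (<⇒≱ (≤-<-trans w₁≤w₂ (liftsHead≡false⇒descent w₂ W x₂ X lifts)) x₂≤w₁)

liftLater : ∀ n w₁ w₂ W x₁ X → NoInvTriples (w₁ ∷ w₂ ∷ W) (x₁ ∷ X) → Ascending (w₁ ∷ w₂ ∷ W) →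
  All (_≤ n) (w₁ ∷ w₂ ∷ W) → liftsHead (w₁ ∷ w₂ ∷ W) (x₁ ∷ X) ≡ false → Lift n (w₂ ∷ W) X →
  Lift n (w₁ ∷ w₂ ∷ W) (x₁ ∷ X)
liftLater n w₁ w₂ W x₁ X (cs , g) (w₁≤ ∷ _) (w₁≤n ∷ _) notLifts L with lessView w₁ x₁
... | notLess _ w₁≮ᵇx₁ rewrite w₁≮ᵇx₁ = ⊥-elim (true≢false notLifts)
... | less w₁<x₁ w₁<ᵇx₁ = record
  { rest       = w₁ ∷ rest
  ; lifted     = lifted
  ; insert≡    = trans (cong (λ b → if b then lifted ∷ w₁ ∷ rest else w₁ ∷ insert lifted rest)
                              (≥⇒<ᵇ≡false (≤-trans (<⇒≤ w₁<x₁) x₁≤)))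
                       (cong (w₁ ∷_) insert≡)
  ; length≡    = cong suc length≡
  ; triples    = ++⁺ cs (((λ _ → inj₂ x₁≤) , (λ x₁≤w₁ → ⊥-elim (<⇒≱ w₁<x₁ x₁≤w₁))) ∷ []) , triples
  ; ascending  = ++⁺ (All-insert⁻ lifted rest (subst (All (w₁ ≤_)) (sym insert≡) w₁≤)) (w₁≤n ∷ []) ∷ ascending
  ; headLifted = λ lifts → ⊥-elim (true≢false (trans (sym lifts) notLifts))
  ; X≤lifted   = λ _ → x₁≤
  }
  where
  open Lift L
  x₁≤ : x₁ ≤ lifted
  x₁≤ = x₁≤lifted n w₁ w₂ W x₁ X (All.head w₁≤) w₁<x₁ cs
    (subst (λ b → (if b then (w₂ <ᵇ x₁) ∧ liftsHead (w₂ ∷ W) X else true) ≡ false) w₁<ᵇx₁ notLifts) L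

lift : ∀ n W X → length W ≡ suc (length X) → NoInvTriples W X → Ascending W → Unique W → All (_≤ n) W → Lift n W X
lift n (w₁ ∷ [])     []       le g W↗ W! W≤n = liftHead n w₁ [] [] le g W↗ W! W≤n refl
lift n (w₁ ∷ w₂ ∷ W) (x₁ ∷ X) le g W↗ W! W≤n with liftsHead (w₁ ∷ w₂ ∷ W) (x₁ ∷ X) in lifts
... | true  = liftHead n w₁ (w₂ ∷ W) (x₁ ∷ X) le g W↗ W! W≤n lifts
... | false = liftLater n w₁ w₂ W x₁ X g W↗ W≤n lifts
  (lift n (w₂ ∷ W) X (suc-injective le) (proj₂ g) (AllPairs.tail W↗) (AllPairs.tail W!) (All.tail W≤n))

entries-suc : ∀ k → entries (suc k) ≡ entries k ++ suc k ∷ []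
entries-suc k = sym (applyUpTo-∷ʳ suc k)

∈-entries⇒≤ : ∀ k {x} → x ∈ entries k → x ≤ k
∈-entries⇒≤ k x∈ with i , i<k , refl ← ∈-applyUpTo⁻ suc x∈ = i<k

max∈entries : ∀ k → suc k ∈ entries (suc k)
max∈entries k = ∈-applyUpTo⁺ suc ≤-refl

entries-unique : ∀ k → Unique (entries k)
entries-unique k = Unique.applyUpTo⁺₁ suc k (λ i<j _ → <⇒≢ i<j ∘ suc-injective)

↭-entries-suc : ∀ k xs → xs ↭ entries k → suc k ∷ xs ↭ entries (suc k)
↭-entries-suc k xs xs↭ = ↭-trans (prep (suc k) xs↭) (↭-trans (∷↭∷ʳ (suc k) (entries k)) (↭-reflexive (sym (entries-suc k))))

↭-entries-suc⁻ : ∀ k xs → suc k ∷ xs ↭ entries (suc k) → xs ↭ entries k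
↭-entries-suc⁻ k xs p = drop-∷ (↭-trans p (↭-sym (↭-entries-suc k (entries k) ↭-refl)))

↭-entries-without-max : ∀ k V r → (V ++ suc k ∷ []) ++ r ↭ entries (suc k) → V ++ r ↭ entries k
↭-entries-without-max k V r p = ↭-entries-suc⁻ k (V ++ r)
  (↭-trans (↭-sym (shift (suc k) V r)) (↭-trans (↭-reflexive (sym (++-assoc V (suc k ∷ []) r))) p))

↭-entries-with-max : ∀ k V r → V ++ r ↭ entries k → (V ++ suc k ∷ []) ++ r ↭ entries (suc k)
↭-entries-with-max k V r p =
  ↭-trans (↭-reflexive (++-assoc V (suc k ∷ []) r)) (↭-trans (shift (suc k) V r) (↭-entries-suc k (V ++ r) p))

↭-entries-moveDown : ∀ k V U m → (V ++ suc k ∷ []) ++ U ++ m ∷ [] ↭ entries (suc k) → insert m V ++ U ↭ entries k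
↭-entries-moveDown k V U m p = ↭-trans (++⁺ʳ U (insert-↭ m V)) (↭-trans (∷↭∷ʳ m (V ++ U))
  (↭-trans (↭-reflexive (++-assoc V U (m ∷ []))) (↭-entries-without-max k V (U ++ m ∷ []) p)))

↭-entries-lift : ∀ k V U m → insert m V ++ U ↭ entries k → (V ++ suc k ∷ []) ++ U ++ m ∷ [] ↭ entries (suc k)
↭-entries-lift k V U m p = ↭-entries-with-max k V (U ++ m ∷ [])
  (↭-trans (↭-reflexive (sym (++-assoc V U (m ∷ [])))) (↭-trans (↭-sym (∷↭∷ʳ m (V ++ U)))
    (↭-trans (++⁺ʳ U (↭-sym (insert-↭ m V))) p)))

unique-++⁻ : ∀ (xs ys : List ℕ) → Unique (xs ++ ys) → Unique xs × Unique ys × Disjoint xs ys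
unique-++⁻ []       ys ys!           = [] , ys! , λ ()
unique-++⁻ (x ∷ xs) ys (x≢ ∷ xs++ys!) =
  let (xs! , ys! , xs#ys) = unique-++⁻ xs ys xs++ys!
  in (++⁻ˡ xs x≢ ∷ xs!) , ys! , λ where
       (here refl , x∈ys) → All.lookup (++⁻ʳ xs x≢) x∈ys refl
       (there v∈xs , v∈ys) → xs#ys (v∈xs , v∈ys)

member≡true⇒∈ : ∀ n xs → member n xs ≡ true → n ∈ xs
member≡true⇒∈ n (x ∷ xs) e with equalView n x
... | equal n≡x _ = here n≡x
... | notEqual _ n≢ᵇx rewrite n≢ᵇx = there (member≡true⇒∈ n xs e)

member≡false⇒∉ : ∀ n xs → member n xs ≡ false → n ∉ xs
member≡false⇒∉ n (x ∷ xs) e n∈ with equalView n x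
... | equal _ n≡ᵇx rewrite n≡ᵇx = true≢false e
member≡false⇒∉ n (x ∷ xs) e (here n≡x)  | notEqual n≢x _ = n≢x n≡x
member≡false⇒∉ n (x ∷ xs) e (there n∈) | notEqual _ n≢ᵇx rewrite n≢ᵇx = member≡false⇒∉ n xs e n∈

removeEntry-↭ : ∀ n xs → n ∈ xs → xs ↭ n ∷ removeEntry n xs
removeEntry-↭ n (x ∷ xs) n∈ with equalView n x
... | equal refl n≡ᵇx rewrite n≡ᵇx = ↭-refl
... | notEqual n≢x n≢ᵇx rewrite n≢ᵇx with n∈
...   | here n≡x  = ⊥-elim (n≢x n≡x)
...   | there n∈′ = ↭-trans (prep x (removeEntry-↭ n xs n∈′)) (swap x n ↭-refl)

∈-removeEntry⁻ : ∀ n xs {x} → x ∈ removeEntry n xs → x ∈ xs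
∈-removeEntry⁻ n (y ∷ ys) x∈ with n ≡ᵇ y
... | true = there x∈
∈-removeEntry⁻ n (y ∷ ys) (here x≡y) | false = here x≡y
∈-removeEntry⁻ n (y ∷ ys) (there x∈) | false = there (∈-removeEntry⁻ n ys x∈)

removeEntry-∷ʳ : ∀ n V → n ∉ V → removeEntry n (V ++ n ∷ []) ≡ V
removeEntry-∷ʳ n []      _  rewrite ≡ᵇ-refl n = refl
removeEntry-∷ʳ n (v ∷ V) n∉ with equalView n v
... | equal n≡v _       = ⊥-elim (n∉ (here n≡v))
... | notEqual _ n≢ᵇv rewrite n≢ᵇv = cong (v ∷_) (removeEntry-∷ʳ n V (n∉ ∘ there))

member-∷ʳ : ∀ n V → member n (V ++ n ∷ []) ≡ true
member-∷ʳ n []      rewrite ≡ᵇ-refl n = refl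
member-∷ʳ n (v ∷ V) with n ≡ᵇ v
... | true  = refl
... | false = member-∷ʳ n V

initL-∷ʳ : ∀ U m → initL (U ++ m ∷ []) ≡ U
initL-∷ʳ []           m = refl
initL-∷ʳ (u ∷ [])     m = refl
initL-∷ʳ (u ∷ u′ ∷ U) m = cong (u ∷_) (initL-∷ʳ (u′ ∷ U) m)

lastL-∷ʳ : ∀ U m → lastL (U ++ m ∷ []) ≡ m ∷ []
lastL-∷ʳ []           m = refl
lastL-∷ʳ (u ∷ [])     m = refl
lastL-∷ʳ (u ∷ u′ ∷ U) m = lastL-∷ʳ (u′ ∷ U) m

∷ʳ-view : ∀ (r : List ℕ) → 1 ≤ length r → ∃ λ U → ∃ λ m → r ≡ U ++ m ∷ []
∷ʳ-view (x ∷ [])    _ = [] , x , refl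
∷ʳ-view (x ∷ y ∷ r) _ with U , m , r≡ ← ∷ʳ-view (y ∷ r) (s≤s z≤n) = x ∷ U , m , cong (x ∷_) r≡

ascending-max⇒∷ʳ : ∀ x r → Ascending r → x ∈ r → All (_≤ x) r → Unique r → ∃ λ V → r ≡ V ++ x ∷ []
ascending-max⇒∷ʳ x (x ∷ ys) (x≤ys ∷ _) (here refl) (_ ∷ ys≤x) (x≢ys ∷ _) = [] , cong (x ∷_) (noneAfter ys x≤ys ys≤x x≢ys)
  where
  noneAfter : ∀ ys → All (x ≤_) ys → All (_≤ x) ys → All (x ≢_) ys → ys ≡ []
  noneAfter []      _          _          _         = refl
  noneAfter (y ∷ _) (x≤y ∷ _) (y≤x ∷ _) (x≢y ∷ _) = ⊥-elim (x≢y (≤-antisym x≤y y≤x))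
ascending-max⇒∷ʳ x (y ∷ ys) (_ ∷ ys↗) (there x∈) (_ ∷ ys≤x) (_ ∷ ys!) =
  let (V , ys≡) = ascending-max⇒∷ʳ x ys ys↗ x∈ ys≤x ys! in y ∷ V , cong (y ∷_) ys≡

ψ-row1 : ∀ N r₁ r₂ → member N r₁ ≡ true → ψ N (r₁ , r₂) ≡ down N (r₁ , r₂)
ψ-row1 N r₁ r₂ e rewrite e = refl

ψ-row2 : ∀ N r₁ r₂ → member N r₁ ≡ false → ψ N (r₁ , r₂) ≡ arrangeTop (r₁ , removeEntry N r₂)
ψ-row2 N r₁ r₂ e rewrite e = refl

down-full : ∀ N r₁ r₂ → (length r₂ ≡ᵇ length r₁) ≡ true →
  down N (r₁ , r₂) ≡ arrangeRows (removeEntry N r₁ ++ lastL r₂ , initL r₂)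
down-full N r₁ r₂ e rewrite e = refl

down-short : ∀ N r₁ r₂ → (length r₂ ≡ᵇ length r₁) ≡ false → down N (r₁ , r₂) ≡ arrangeRows (removeEntry N r₁ , r₂)
down-short N r₁ r₂ e rewrite e = refl

ψ-short : ∀ N V r₂ → N ∉ V → (length r₂ ≡ᵇ length (V ++ N ∷ [])) ≡ false →
  ψ N (V ++ N ∷ [] , r₂) ≡ arrangeRows (V , r₂)
ψ-short N V r₂ N∉V short = begin
  ψ N (V ++ N ∷ [] , r₂)                       ≡⟨ ψ-row1 N (V ++ N ∷ []) r₂ (member-∷ʳ N V) ⟩
  down N (V ++ N ∷ [] , r₂)                    ≡⟨ down-short N (V ++ N ∷ []) r₂ short ⟩
  arrangeRows (removeEntry N (V ++ N ∷ []) , r₂) ≡⟨ cong (λ x → arrangeRows (x , r₂)) (removeEntry-∷ʳ N V N∉V) ⟩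
  arrangeRows (V , r₂)                         ∎
  where open ≡-Reasoning

ψ-full : ∀ N V U m → N ∉ V → length (U ++ m ∷ []) ≡ length (V ++ N ∷ []) →
  ψ N (V ++ N ∷ [] , U ++ m ∷ []) ≡ arrangeRows (V ++ m ∷ [] , U)
ψ-full N V U m N∉V full = begin
  ψ N (V ++ N ∷ [] , U ++ m ∷ [])
    ≡⟨ ψ-row1 N (V ++ N ∷ []) (U ++ m ∷ []) (member-∷ʳ N V) ⟩
  down N (V ++ N ∷ [] , U ++ m ∷ [])
    ≡⟨ down-full N (V ++ N ∷ []) (U ++ m ∷ []) (≡⇒≡ᵇ≡true full) ⟩
  arrangeRows (removeEntry N (V ++ N ∷ []) ++ lastL (U ++ m ∷ []) , initL (U ++ m ∷ []))
    ≡⟨ cong₂ (λ x y → arrangeRows (x , y)) (cong₂ _++_ (removeEntry-∷ʳ N V N∉V) (lastL-∷ʳ U m)) (initL-∷ʳ U m) ⟩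
  arrangeRows (V ++ m ∷ [] , U) ∎
  where open ≡-Reasoning

corner-short : ∀ a b → (a ≡ᵇ b) ≡ false → corner a b 1 ≡ (a ∸ 1 , b)
corner-short a b e rewrite e = refl

corner-full : ∀ a → corner a a 1 ≡ (a , a ∸ 1)
corner-full a rewrite ≡ᵇ-refl a = refl

dd≡ : ∀ N σ τ k → ψ N σ ≡ τ → maj σ ≡ k + maj τ → dd N σ ≡ ℤ.+ k
dd≡ N σ τ k ψ≡ maj≡ rewrite ψ≡ = m≡k+n⇒+m-+n≡+k (maj σ) (maj τ) k maj≡

record Admissible (n : ℕ) (r₁ r₂ : List ℕ) : Set where
  field
    r₁-unique : Unique r₁
    r₂-unique : Unique r₂
    disjoint  : Disjoint r₂ r₁
    r₁≤n      : All (_≤ n) r₁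
    r₂≤n      : All (_≤ n) r₂
    r₁↗       : Ascending r₁
    triples   : NoInvTriples r₁ r₂

admissible : ∀ n r₁ r₂ → length r₂ ≤ length r₁ → r₁ ++ r₂ ↭ entries n → InvFree (r₁ , r₂) → Admissible n r₁ r₂
admissible n r₁ r₂ le p free = record
  { r₁-unique = proj₁ split
  ; r₂-unique = proj₁ (proj₂ split)
  ; disjoint  = λ (x∈r₂ , x∈r₁) → proj₂ (proj₂ split) (x∈r₁ , x∈r₂)
  ; r₁≤n      = All.tabulate (bound ∘ ∈-++⁺ˡ)
  ; r₂≤n      = All.tabulate (bound ∘ ∈-++⁺ʳ r₁)
  ; r₁↗       = proj₁ (invFree⇒ascending×noInvTriples r₁ r₂ le free)
  ; triples   = proj₂ (invFree⇒ascending×noInvTriples r₁ r₂ le free)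
  }
  where
  split : Unique r₁ × Unique r₂ × Disjoint r₁ r₂
  split = unique-++⁻ r₁ r₂ (unique-resp-↭ (↭-sym p) (entries-unique n))
  bound : ∀ {x} → x ∈ r₁ ++ r₂ → x ≤ n
  bound = ∈-entries⇒≤ n ∘ ∈-resp-↭ p

data Case (a b n : ℕ) (r₁ r₂ : List ℕ) : Set where
  shortRow1 : ∀ V → r₁ ≡ V ++ suc n ∷ [] → b ≢ a → ψ (suc n) (r₁ , r₂) ≡ (V , r₂) →
    dd (suc n) (r₁ , r₂) ≡ ℤ.+ 0 → IFF (corner a b 1) n (V , r₂) → Case a b n r₁ r₂
  fullRow1 : ∀ V U m → r₁ ≡ V ++ suc n ∷ [] → r₂ ≡ U ++ m ∷ [] → b ≡ a → ψ (suc n) (r₁ , r₂) ≡ (insert m V , U) →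
    dd (suc n) (r₁ , r₂) ≡ ℤ.+ 0 → IFF (corner a b 1) n (insert m V , U) →
    length U ≡ length V → NoInvTriples (V ++ suc n ∷ []) (U ++ m ∷ []) → Ascending V → m ∉ V → Case a b n r₁ r₂
  inRow2 : suc n ∈ r₂ → ψ (suc n) (r₁ , r₂) ≡ (r₁ , removeEntry (suc n) r₂) → dd (suc n) (r₁ , r₂) ≡ ℤ.+ 1 →
    IFF (corner a b 2) n (r₁ , removeEntry (suc n) r₂) → r₂ ≡ insertMax (suc n) r₁ (removeEntry (suc n) r₂) →
    Case a b n r₁ r₂

caseInRow2 : ∀ a b n r₁ r₂ → b ≤ a → length r₁ ≡ a → length r₂ ≡ b → r₁ ++ r₂ ↭ entries (suc n) →
  Admissible (suc n) r₁ r₂ → member (suc n) r₁ ≡ false → Case a b n r₁ r₂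
caseInRow2 a b n r₁ r₂ b≤a l₁ l₂ p S notMember =
  inRow2 N∈r₂ ψ≡ (dd≡ (suc n) (r₁ , r₂) (r₁ , rem) 1 ψ≡ (proj₁ (proj₂ removal)))
    ((l₁ , length-rem , rem-entries) , ascending×noInvTriples⇒invFree r₁ rem le′ r₁↗ (proj₁ removal))
    (sym (proj₂ (proj₂ removal)))
  where
  open Admissible S
  N∉r₁ : suc n ∉ r₁
  N∉r₁ = member≡false⇒∉ (suc n) r₁ notMember
  N∈r₂ : suc n ∈ r₂
  N∈r₂ with ∈-++⁻ r₁ (∈-resp-↭ (↭-sym p) (max∈entries n))
  ... | inj₁ N∈r₁ = ⊥-elim (N∉r₁ N∈r₁)
  ... | inj₂ N∈r₂ = N∈r₂
  rem : List ℕ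
  rem = removeEntry (suc n) r₂
  r₂↭ : r₂ ↭ suc n ∷ rem
  r₂↭ = removeEntry-↭ (suc n) r₂ N∈r₂
  le : length r₂ ≤ length r₁
  le = subst₂ _≤_ (sym l₂) (sym l₁) b≤a
  le′ : length rem ≤ length r₁
  le′ = ≤-trans (n≤1+n _) (subst (_≤ length r₁) (↭-length r₂↭) le)
  length-rem : length rem ≡ b ∸ 1
  length-rem = cong (_∸ 1) (trans (sym (↭-length r₂↭)) l₂)
  r₁<N : All (_< suc n) r₁
  r₁<N = All.tabulate λ x∈ → ≤∧≢⇒< (All.lookup r₁≤n x∈) (λ x≡N → N∉r₁ (subst (_∈ r₁) x≡N x∈))
  removal : NoInvTriples r₁ rem × majCols r₁ r₂ ≡ suc (majCols r₁ rem) × insertMax (suc n) r₁ rem ≡ r₂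
  removal = removeMax-top (suc n) r₁ r₂ le r₁↗ triples r₁<N r₂≤n r₂-unique N∈r₂
  ψ≡ : ψ (suc n) (r₁ , r₂) ≡ (r₁ , rem)
  ψ≡ = trans (ψ-row2 (suc n) r₁ r₂ notMember)
    (arrangeTop-unique r₁ rem rem ↭-refl le′ r₁↗ (proj₁ removal) (AllPairs.tail (unique-resp-↭ r₂↭ r₂-unique))
       (λ (x∈rem , x∈r₁) → disjoint (∈-removeEntry⁻ (suc n) r₂ x∈rem , x∈r₁)))
  rem-entries : r₁ ++ rem ↭ entries n
  rem-entries = ↭-entries-suc⁻ n (r₁ ++ rem) (↭-trans (↭-sym (shift (suc n) r₁ rem)) (↭-trans (++⁺ˡ r₁ (↭-sym r₂↭)) p))

caseShortRow1 : ∀ a b n V r₂ → b ≤ a → length (V ++ suc n ∷ []) ≡ a → length r₂ ≡ b →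
  length r₂ ≢ length (V ++ suc n ∷ []) → (length r₂ ≡ᵇ length (V ++ suc n ∷ [])) ≡ false →
  (V ++ suc n ∷ []) ++ r₂ ↭ entries (suc n) → Admissible (suc n) (V ++ suc n ∷ []) r₂ →
  Case a b n (V ++ suc n ∷ []) r₂
caseShortRow1 a b n V r₂ b≤a l₁ l₂ r₂≢r₁ r₂≢ᵇr₁ p S =
  shortRow1 V refl b≢a ψ≡ (dd≡ (suc n) (V ++ suc n ∷ [] , r₂) (V , r₂) 0 ψ≡ (majCols-++ V (suc n ∷ []) r₂ le))
    (subst (λ sh → IFF sh n (V , r₂)) (sym (corner-short a b a≢ᵇb))
       ((length-V , l₂ , ↭-entries-without-max n V r₂ p) , ascending×noInvTriples⇒invFree V r₂ le V↗ triples′))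
  where
  open Admissible S
  b≢a : b ≢ a
  b≢a b≡a = r₂≢r₁ (trans l₂ (trans b≡a (sym l₁)))
  a≢ᵇb : (a ≡ᵇ b) ≡ false
  a≢ᵇb with equalView a b
  ... | equal a≡b _     = ⊥-elim (b≢a (sym a≡b))
  ... | notEqual _ a≢ᵇb = a≢ᵇb
  length-V : length V ≡ a ∸ 1
  length-V = cong (_∸ 1) (trans (sym (length-∷ʳ V (suc n))) l₁)
  le : length r₂ ≤ length V
  le = ≤-pred (≤∧≢⇒< (subst₂ _≤_ (sym l₂) (trans (sym l₁) (length-∷ʳ V (suc n))) b≤a)
                     (λ r₂≡ → r₂≢r₁ (trans r₂≡ (sym (length-∷ʳ V (suc n))))))
  V↗ : Ascending V
  V↗ = ascending-++⁻ˡ V (suc n ∷ []) r₁↗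
  triples′ : NoInvTriples V r₂
  triples′ = noInvTriples-++⁻ V (suc n ∷ []) r₂ le triples
  N∉V : suc n ∉ V
  N∉V N∈V = proj₂ (proj₂ (unique-++⁻ V (suc n ∷ []) r₁-unique)) (N∈V , here refl)
  ψ≡ : ψ (suc n) (V ++ suc n ∷ [] , r₂) ≡ (V , r₂)
  ψ≡ = trans (ψ-short (suc n) V r₂ N∉V r₂≢ᵇr₁)
    (arrangeRows-unique V r₂ V r₂ ↭-refl ↭-refl le V↗ triples′ r₂-unique (λ (x∈r₂ , x∈V) → disjoint (x∈r₂ , ∈-++⁺ˡ x∈V)))

caseFullRow1 : ∀ a n V U m → length (V ++ suc n ∷ []) ≡ a → length (U ++ m ∷ []) ≡ a →
  (V ++ suc n ∷ []) ++ U ++ m ∷ [] ↭ entries (suc n) → Admissible (suc n) (V ++ suc n ∷ []) (U ++ m ∷ []) →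
  Case a a n (V ++ suc n ∷ []) (U ++ m ∷ [])
caseFullRow1 a n V U m l₁ l₂ p S =
  fullRow1 V U m refl refl refl ψ≡ (dd≡ (suc n) (V ++ suc n ∷ [] , U ++ m ∷ []) (insert m V , U) 0 ψ≡ (proj₂ moved))
    (subst (λ sh → IFF sh n (insert m V , U)) (sym (corner-full a))
       ((length-insert , length-U , ↭-entries-moveDown n V U m p) ,
        ascending×noInvTriples⇒invFree (insert m V) U le (insert-ascending m V V↗) (proj₁ moved)))
    length≡ triples V↗ m∉V
  where
  open Admissible S
  m∈ : m ∈ U ++ m ∷ []
  m∈ = ∈-++⁺ʳ U (here refl)
  U!×U#m : Unique U × Unique (m ∷ []) × Disjoint U (m ∷ [])
  U!×U#m = unique-++⁻ U (m ∷ []) r₂-unique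
  m∉U : m ∉ U
  m∉U m∈U = proj₂ (proj₂ U!×U#m) (m∈U , here refl)
  m∉V : m ∉ V
  m∉V m∈V = disjoint (m∈ , ∈-++⁺ˡ m∈V)
  N∉V : suc n ∉ V
  N∉V N∈V = proj₂ (proj₂ (unique-++⁻ V (suc n ∷ []) r₁-unique)) (N∈V , here refl)
  m<N : m < suc n
  m<N = ≤∧≢⇒< (All.lookup r₂≤n m∈) (λ m≡N → disjoint (m∈ , ∈-++⁺ʳ V (here m≡N)))
  V↗ : Ascending V
  V↗ = ascending-++⁻ˡ V (suc n ∷ []) r₁↗
  length≡ : length U ≡ length V
  length≡ = suc-injective (trans (sym (length-∷ʳ U m)) (trans l₂ (trans (sym l₁) (length-∷ʳ V (suc n)))))
  moved : NoInvTriples (insert m V) U × majCols (V ++ suc n ∷ []) (U ++ m ∷ []) ≡ majCols (insert m V) U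
  moved = moveDown (suc n) m V U length≡ triples r₁↗ m<N
  le : length U ≤ length (insert m V)
  le = ≤-trans (≤-reflexive length≡) (≤-trans (n≤1+n _) (≤-reflexive (sym (↭-length (insert-↭ m V)))))
  length-insert : length (insert m V) ≡ a
  length-insert = trans (↭-length (insert-↭ m V)) (trans (sym (length-∷ʳ V (suc n))) l₁)
  length-U : length U ≡ a ∸ 1
  length-U = cong (_∸ 1) (trans (sym (length-∷ʳ U m)) l₂)
  U#insert : Disjoint U (insert m V)
  U#insert (x∈U , x∈insert) with ∈-resp-↭ (insert-↭ m V) x∈insert
  ... | here refl = m∉U x∈U
  ... | there x∈V = disjoint (∈-++⁺ˡ x∈U , ∈-++⁺ˡ x∈V)
  ψ≡ : ψ (suc n) (V ++ suc n ∷ [] , U ++ m ∷ []) ≡ (insert m V , U)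
  ψ≡ = trans (ψ-full (suc n) V U m N∉V (trans l₂ (sym l₁)))
    (arrangeRows-unique (V ++ m ∷ []) U (insert m V) U (↭-trans (insert-↭ m V) (∷↭∷ʳ m V)) ↭-refl le
       (insert-ascending m V V↗) (proj₁ moved) (proj₁ U!×U#m) U#insert)

caseRow1 : ∀ a b n r₁ r₂ → 1 ≤ b → b ≤ a → length r₁ ≡ a → length r₂ ≡ b → r₁ ++ r₂ ↭ entries (suc n) →
  Admissible (suc n) r₁ r₂ → suc n ∈ r₁ → Case a b n r₁ r₂
caseRow1 a b n r₁ r₂ 1≤b b≤a l₁ l₂ p S N∈r₁
  with ascending-max⇒∷ʳ (suc n) r₁ (Admissible.r₁↗ S) N∈r₁ (Admissible.r₁≤n S) (Admissible.r₁-unique S)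
... | V , refl with equalView (length r₂) (length (V ++ suc n ∷ []))
...   | notEqual r₂≢r₁ r₂≢ᵇr₁ = caseShortRow1 a b n V r₂ b≤a l₁ l₂ r₂≢r₁ r₂≢ᵇr₁ p S
...   | equal r₂≡r₁ _ with ∷ʳ-view r₂ (subst (1 ≤_) (sym l₂) 1≤b)
...     | U , m , refl with refl ← trans (sym l₂) (trans r₂≡r₁ l₁) = caseFullRow1 a n V U m l₁ l₂ p S

classify : ∀ a b n r₁ r₂ → 1 ≤ b → b ≤ a → length r₁ ≡ a → length r₂ ≡ b → r₁ ++ r₂ ↭ entries (suc n) →
  InvFree (r₁ , r₂) → Case a b n r₁ r₂
classify a b n r₁ r₂ 1≤b b≤a l₁ l₂ p free with member (suc n) r₁ in isMember
... | true  = caseRow1 a b n r₁ r₂ 1≤b b≤a l₁ l₂ p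
  (admissible (suc n) r₁ r₂ (subst₂ _≤_ (sym l₂) (sym l₁) b≤a) p free) (member≡true⇒∈ (suc n) r₁ isMember)
... | false = caseInRow2 a b n r₁ r₂ b≤a l₁ l₂ p
  (admissible (suc n) r₁ r₂ (subst₂ _≤_ (sym l₂) (sym l₁) b≤a) p free) isMember

-- The bijection

ψ-forward : ∀ a b n → 1 ≤ b → b ≤ a → (σ : Filling) → IFF (a , b) (suc n) σ →
  ∃[ k ] (k ≤ 1 × dd (suc n) σ ≡ ℤ.+ k × IFF (corner a b (suc k)) n (ψ (suc n) σ))
ψ-forward a b n 1≤b b≤a (r₁ , r₂) ((l₁ , l₂ , p) , free) with classify a b n r₁ r₂ 1≤b b≤a l₁ l₂ p free
... | shortRow1 _ _ _ ψ≡ d τ-ok               = 0 , z≤n , d , subst (IFF (corner a b 1) n) (sym ψ≡) τ-ok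
... | fullRow1 _ _ _ _ _ _ ψ≡ d τ-ok _ _ _ _ = 0 , z≤n , d , subst (IFF (corner a b 1) n) (sym ψ≡) τ-ok
... | inRow2 _ ψ≡ d τ-ok _                    = 1 , s≤s z≤n , d , subst (IFF (corner a b 2) n) (sym ψ≡) τ-ok

+0≢+1 : ℤ.+ 0 ≢ ℤ.+ 1
+0≢+1 ()

fullRow1-injective : ∀ n V V′ U m m′ → length U ≡ length V → length U ≡ length V′ →
  NoInvTriples (V ++ suc n ∷ []) (U ++ m ∷ []) → NoInvTriples (V′ ++ suc n ∷ []) (U ++ m′ ∷ []) →
  Ascending V → Ascending V′ → m ∉ V → m′ ∉ V′ → insert m V ≡ insert m′ V′ → m ≡ m′ × V ≡ V′
fullRow1-injective n V V′ U m m′ l l′ g g′ V↗ V′↗ m∉V m′∉V′ insert≡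
  with refl ← moveDown-injective (suc n) m m′ V V′ U l l′ g g′ V↗ V′↗ m∉V m′∉V′ insert≡ =
  refl , ascending-↭⇒≡ V↗ V′↗ (drop-∷ (↭-trans (↭-sym (insert-↭ m V)) (↭-trans (↭-reflexive insert≡) (insert-↭ m V′))))

ψ-injective : ∀ a b n → 1 ≤ b → b ≤ a → (σ σ′ : Filling) → IFF (a , b) (suc n) σ → IFF (a , b) (suc n) σ′ →
  ψ (suc n) σ ≡ ψ (suc n) σ′ → dd (suc n) σ ≡ dd (suc n) σ′ → σ ≡ σ′
ψ-injective a b n 1≤b b≤a (r₁ , r₂) (r₁′ , r₂′) ((l₁ , l₂ , p) , free) ((l₁′ , l₂′ , p′) , free′) ψ≡ d≡
  with classify a b n r₁ r₂ 1≤b b≤a l₁ l₂ p free | classify a b n r₁′ r₂′ 1≤b b≤a l₁′ l₂′ p′ free′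
... | shortRow1 _ refl _ ψ₁ _ _ | shortRow1 _ refl _ ψ₂ _ _ with refl ← trans (sym ψ₁) (trans ψ≡ ψ₂) = refl
... | shortRow1 _ _ b≢a _ _ _ | fullRow1 _ _ _ _ _ b≡a _ _ _ _ _ _ _ = ⊥-elim (b≢a b≡a)
... | fullRow1 _ _ _ _ _ b≡a _ _ _ _ _ _ _ | shortRow1 _ _ b≢a _ _ _ = ⊥-elim (b≢a b≡a)
... | shortRow1 _ _ _ _ d _ | inRow2 _ _ d′ _ _ = ⊥-elim (+0≢+1 (trans (sym d) (trans d≡ d′)))
... | fullRow1 _ _ _ _ _ _ _ d _ _ _ _ _ | inRow2 _ _ d′ _ _ = ⊥-elim (+0≢+1 (trans (sym d) (trans d≡ d′)))
... | inRow2 _ _ d _ _ | shortRow1 _ _ _ _ d′ _ = ⊥-elim (+0≢+1 (trans (sym d′) (trans (sym d≡) d)))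
... | inRow2 _ _ d _ _ | fullRow1 _ _ _ _ _ _ _ d′ _ _ _ _ _ = ⊥-elim (+0≢+1 (trans (sym d′) (trans (sym d≡) d)))
... | inRow2 _ ψ₁ _ _ r₂≡ | inRow2 _ ψ₂ _ _ r₂′≡ with trans (sym ψ₁) (trans ψ≡ ψ₂)
...   | τ≡ with refl ← cong proj₁ τ≡ = cong (r₁ ,_) (trans r₂≡ (trans (cong (insertMax (suc n) r₁ ∘ proj₂) τ≡) (sym r₂′≡)))
ψ-injective a b n 1≤b b≤a _ _ _ _ ψ≡ d≡
  | fullRow1 V U m refl refl _ ψ₁ _ _ l g V↗ m∉V | fullRow1 V′ U′ m′ refl refl _ ψ₂ _ _ l′ g′ V′↗ m′∉V′
  with τ≡ ← trans (sym ψ₁) (trans ψ≡ ψ₂) with refl ← cong proj₂ τ≡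
  with refl , refl ← fullRow1-injective n V V′ U m m′ l l′ g g′ V↗ V′↗ m∉V m′∉V′ (cong proj₁ τ≡) = refl

short-case⇒ψ : ∀ a b n W r₂ → b ≢ a → suc n ∉ r₂ → Case a b n (W ++ suc n ∷ []) r₂ →
  ψ (suc n) (W ++ suc n ∷ [] , r₂) ≡ (W , r₂) × dd (suc n) (W ++ suc n ∷ [] , r₂) ≡ ℤ.+ 0
short-case⇒ψ a b n W r₂ _   _   (shortRow1 V e _ ψ≡ d _) with refl ← ∷ʳ-injectiveˡ W V e = ψ≡ , d
short-case⇒ψ a b n W r₂ b≢a _   (fullRow1 _ _ _ _ _ b≡a _ _ _ _ _ _ _) = ⊥-elim (b≢a b≡a)
short-case⇒ψ a b n W r₂ _   N∉r₂ (inRow2 N∈r₂ _ _ _ _) = ⊥-elim (N∉r₂ N∈r₂)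

ψ-surjective-short : ∀ a b n → 1 ≤ b → b ≤ a → b ≢ a → (W X : List ℕ) → IFF (a ∸ 1 , b) n (W , X) →
  ∃[ σ ] (IFF (a , b) (suc n) σ × ψ (suc n) σ ≡ (W , X) × dd (suc n) σ ≡ ℤ.+ 0)
ψ-surjective-short a b n 1≤b b≤a b≢a W X ((lW , lX , p) , free) =
  (W ++ suc n ∷ [] , X) , ((lσ , lX , pσ) , σ-free) ,
  short-case⇒ψ a b n W X b≢a (λ N∈X → 1+n≰n (All.lookup r₂≤n N∈X))
    (classify a b n (W ++ suc n ∷ []) X 1≤b b≤a lσ lX pσ σ-free)
  where
  1≤a : 1 ≤ a
  1≤a = ≤-trans 1≤b b≤a
  le : length X ≤ length W
  le = subst₂ _≤_ (sym lX) (sym lW) (≤-pred (subst (b <_) (sym (suc[n∸1]≡n 1≤a)) (≤∧≢⇒< b≤a b≢a)))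
  open Admissible (admissible n W X le p free)
  lσ : length (W ++ suc n ∷ []) ≡ a
  lσ = trans (length-∷ʳ W (suc n)) (trans (cong suc lW) (suc[n∸1]≡n 1≤a))
  pσ : (W ++ suc n ∷ []) ++ X ↭ entries (suc n)
  pσ = ↭-entries-with-max n W X p
  σ-free : InvFree (W ++ suc n ∷ [] , X)
  σ-free = ascending×noInvTriples⇒invFree (W ++ suc n ∷ []) X (subst₂ _≤_ (sym lX) (sym lσ) b≤a)
    (ascending-∷ʳ⁺ W (suc n) r₁↗ (All.map (λ x≤n → ≤-trans x≤n (n≤1+n n)) r₁≤n))
    (noInvTriples-++⁺ W (suc n ∷ []) X le triples)

full-case⇒ψ : ∀ a n V X w → suc n ∉ X ++ w ∷ [] → Case a a n (V ++ suc n ∷ []) (X ++ w ∷ []) →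
  ψ (suc n) (V ++ suc n ∷ [] , X ++ w ∷ []) ≡ (insert w V , X) × dd (suc n) (V ++ suc n ∷ [] , X ++ w ∷ []) ≡ ℤ.+ 0
full-case⇒ψ a n V X w _ (fullRow1 V′ U m e₁ e₂ _ ψ≡ d _ _ _ _ _)
  with refl ← ∷ʳ-injectiveˡ V V′ e₁ | refl , refl ← ∷ʳ-injective X U e₂ = ψ≡ , d
full-case⇒ψ a n V X w _ (shortRow1 _ _ a≢a _ _ _) = ⊥-elim (a≢a refl)
full-case⇒ψ a n V X w N∉ (inRow2 N∈ _ _ _ _)     = ⊥-elim (N∉ N∈)

ψ-surjective-full : ∀ a n → 1 ≤ a → (W X : List ℕ) → IFF (a , a ∸ 1) n (W , X) →
  ∃[ σ ] (IFF (a , a) (suc n) σ × ψ (suc n) σ ≡ (W , X) × dd (suc n) σ ≡ ℤ.+ 0)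
ψ-surjective-full a n 1≤a W X ((lW , lX , p) , free) =
  σ , ((lσ₁ , lσ₂ , pσ) , σ-free) , subst (λ W′ → ψ (suc n) σ ≡ (W′ , X) × dd (suc n) σ ≡ ℤ.+ 0) insert≡
    (full-case⇒ψ a n rest X lifted N∉ (classify a a n (rest ++ suc n ∷ []) (X ++ lifted ∷ []) 1≤a ≤-refl lσ₁ lσ₂ pσ σ-free))
  where
  le : length X ≤ length W
  le = subst₂ _≤_ (sym lX) (sym lW) (m∸n≤m a 1)
  open Admissible (admissible n W X le p free)
  open Lift (lift (suc n) W X (trans lW (sym (trans (cong suc lX) (suc[n∸1]≡n 1≤a)))) triples r₁↗ r₁-unique
               (All.map (λ x≤n → ≤-trans x≤n (n≤1+n n)) r₁≤n))
    renaming (triples to lifted-triples; ascending to lifted-ascending)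
  σ : Filling
  σ = (rest ++ suc n ∷ [] , X ++ lifted ∷ [])
  lσ₂ : length (X ++ lifted ∷ []) ≡ a
  lσ₂ = trans (length-∷ʳ X lifted) (trans (cong suc lX) (suc[n∸1]≡n 1≤a))
  lσ₁ : length (rest ++ suc n ∷ []) ≡ a
  lσ₁ = trans (length-∷ʳ rest (suc n)) (trans (cong suc (trans length≡ lX)) (suc[n∸1]≡n 1≤a))
  lifted∈W : lifted ∈ W
  lifted∈W = subst (lifted ∈_) insert≡ (∈-resp-↭ (↭-sym (insert-↭ lifted rest)) (here refl))
  N∉ : suc n ∉ X ++ lifted ∷ []
  N∉ N∈ with ∈-++⁻ X N∈
  ... | inj₁ N∈X           = 1+n≰n (All.lookup r₂≤n N∈X)
  ... | inj₂ (here N≡lifted) = 1+n≰n (All.lookup r₁≤n (subst (_∈ W) (sym N≡lifted) lifted∈W))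
  pσ : (rest ++ suc n ∷ []) ++ X ++ lifted ∷ [] ↭ entries (suc n)
  pσ = ↭-entries-lift n rest X lifted (subst (λ W′ → W′ ++ X ↭ entries n) (sym insert≡) p)
  σ-free : InvFree σ
  σ-free = ascending×noInvTriples⇒invFree (rest ++ suc n ∷ []) (X ++ lifted ∷ []) (≤-reflexive (trans lσ₂ (sym lσ₁)))
    lifted-ascending lifted-triples

row2-case⇒ψ : ∀ a b n W X → suc n ∉ W → All (_< suc n) X → Case a b n W (insertMax (suc n) W X) →
  ψ (suc n) (W , insertMax (suc n) W X) ≡ (W , X) × dd (suc n) (W , insertMax (suc n) W X) ≡ ℤ.+ 1
row2-case⇒ψ a b n W X N∉W _ (shortRow1 V W≡ _ _ _ _) =
  ⊥-elim (N∉W (subst (suc n ∈_) (sym W≡) (∈-++⁺ʳ V (here refl))))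
row2-case⇒ψ a b n W X N∉W _ (fullRow1 V _ _ W≡ _ _ _ _ _ _ _ _ _) =
  ⊥-elim (N∉W (subst (suc n ∈_) (sym W≡) (∈-++⁺ʳ V (here refl))))
row2-case⇒ψ a b n W X _ X<N (inRow2 _ ψ≡ d _ _) = trans ψ≡ (cong (W ,_) (removeEntry-insertMax (suc n) W X X<N)) , d

ψ-surjective-row2 : ∀ a b n → 1 ≤ b → b ≤ a → (W X : List ℕ) → IFF (a , b ∸ 1) n (W , X) →
  ∃[ σ ] (IFF (a , b) (suc n) σ × ψ (suc n) σ ≡ (W , X) × dd (suc n) σ ≡ ℤ.+ 1)
ψ-surjective-row2 a b n 1≤b b≤a W X ((lW , lX , p) , free) =
  (W , insertMax (suc n) W X) , ((lW , lI , pσ) , σ-free) ,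
  row2-case⇒ψ a b n W X (λ N∈W → 1+n≰n (All.lookup r₁≤n N∈W)) X<N
    (classify a b n W (insertMax (suc n) W X) 1≤b b≤a lW lI pσ σ-free)
  where
  lt : length X < length W
  lt = subst₂ _<_ (sym lX) (sym lW) (subst (_≤ a) (sym (suc[n∸1]≡n 1≤b)) b≤a)
  open Admissible (admissible n W X (<⇒≤ lt) p free)
  X<N : All (_< suc n) X
  X<N = All.map s≤s r₂≤n
  lI : length (insertMax (suc n) W X) ≡ b
  lI = trans (↭-length (insertMax-↭ (suc n) W X)) (trans (cong suc lX) (suc[n∸1]≡n 1≤b))
  pσ : W ++ insertMax (suc n) W X ↭ entries (suc n)
  pσ = ↭-trans (++⁺ˡ W (insertMax-↭ (suc n) W X)) (↭-trans (shift (suc n) W X) (↭-entries-suc n (W ++ X) p))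
  σ-free : InvFree (W , insertMax (suc n) W X)
  σ-free = ascending×noInvTriples⇒invFree W (insertMax (suc n) W X) (subst₂ _≤_ (sym lI) (sym lW) b≤a) r₁↗
    (insertMax-noInvTriples (suc n) W X lt r₁↗ triples (All.map s≤s r₁≤n) (All.map (λ x≤n → ≤-trans x≤n (n≤1+n n)) r₂≤n))

ψ-surjective : ∀ a b n → 1 ≤ b → b ≤ a → (k : ℕ) → k ≤ 1 → (τ : Filling) → IFF (corner a b (suc k)) n τ →
  ∃[ σ ] (IFF (a , b) (suc n) σ × ψ (suc n) σ ≡ τ × dd (suc n) σ ≡ ℤ.+ k)
ψ-surjective a b n 1≤b b≤a 0 _ (W , X) τ-ok with equalView a b
... | notEqual a≢b a≢ᵇb =
  ψ-surjective-short a b n 1≤b b≤a (a≢b ∘ sym) W X (subst (λ sh → IFF sh n (W , X)) (corner-short a b a≢ᵇb) τ-ok)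
... | equal refl _ = ψ-surjective-full a n 1≤b W X (subst (λ sh → IFF sh n (W , X)) (corner-full a) τ-ok)
ψ-surjective a b n 1≤b b≤a 1 _ (W , X) τ-ok = ψ-surjective-row2 a b n 1≤b b≤a W X τ-ok
ψ-surjective a b n _ _ (suc (suc _)) (s≤s ()) _ _

-- Opened only here: earlier, the prefix +_ would make sections such as (x +_) ambiguous.
open import Data.Integer using (+_)

mainTheorem8 : (μ₁ μ₂ : ℕ) → 1 ≤ μ₂ → μ₂ ≤ μ₁ →
    ((σ : Filling) → IFF (μ₁ , μ₂) (μ₁ + μ₂) σ →
      ∃[ k ] (k ≤ 1 × dd (μ₁ + μ₂) σ ≡ + k
              × IFF (corner μ₁ μ₂ (suc k)) (μ₁ + μ₂ ∸ 1) (ψ (μ₁ + μ₂) σ)))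
    × ((σ σ′ : Filling) → IFF (μ₁ , μ₂) (μ₁ + μ₂) σ → IFF (μ₁ , μ₂) (μ₁ + μ₂) σ′ →
        ψ (μ₁ + μ₂) σ ≡ ψ (μ₁ + μ₂) σ′ → dd (μ₁ + μ₂) σ ≡ dd (μ₁ + μ₂) σ′ → σ ≡ σ′)
    × ((k : ℕ) → k ≤ 1 → (τ : Filling) → IFF (corner μ₁ μ₂ (suc k)) (μ₁ + μ₂ ∸ 1) τ →
        ∃[ σ ] (IFF (μ₁ , μ₂) (μ₁ + μ₂) σ × ψ (μ₁ + μ₂) σ ≡ τ × dd (μ₁ + μ₂) σ ≡ + k))
mainTheorem8 μ₁ (suc b) 1≤μ₂ μ₂≤μ₁ rewrite +-suc μ₁ b =
  ψ-forward μ₁ (suc b) (μ₁ + b) 1≤μ₂ μ₂≤μ₁ ,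
  ψ-injective μ₁ (suc b) (μ₁ + b) 1≤μ₂ μ₂≤μ₁ ,
  ψ-surjective μ₁ (suc b) (μ₁ + b) 1≤μ₂ μ₂≤μ₁
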